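{- Let $n\ge d\ge1$ and $r\ge0$. Let $\mathbb X^r_{d,n-1}$ be the set of all $\psi$-tableaux $X$ of length $r$ such that (x1) $X$ is contained in $\delta_{n-1}$, (x2) row $d$ of $X$ has length $n-d$, and (x3) the prime path of row $d$ of $X$ has height $d$. Let $\mathbb Z^{r+1}_{d,n}$ be the set of all $\psi$-tableaux $Z$ of length $r+1$ such that (z1) $Z$ is contained in $\delta_n$, (z2) rows $d$ and $d+1$ of $Z^{(r)}$ are identical, (z3) the end-box of the $(r+1)$-set of $Z$ is $(d,n-d+1)$, and (z4) the prime path of $(d,n-d+1)$ (i.e. of row $d$ of $Z$) has height $d$. Then: (1) If $X$ is any tableau of length $r$ satisfying (x2) and $Z=\beta_d(\alpha_d(X))$, then each of the first $d$ rows of $Z$ has length one more than the corresponding row of $X$, and each of the first $n-d$ columns of $Z$ has length one more than the corresponding column of $X$. (2) The map $X\mapsto\beta_d(\alpha_d(X))$ is a bijection from $\mathbb X^r_{d,n-1}$ to $\mathbb Z^{r+1}_{d,n}$.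
   Context: Young diagrams use English notation: rows indexed $1,2,\dots$ top to bottom, columns $1,2,\dots$ left to right, $(x,y)$ the box in row $x$, column $y$, row lengths $\lambda_1\ge\lambda_2\ge\cdots$, $\lambda_j=0$ beyond the last row, $\lambda_0=+\infty$. $\delta_m=(m,\dots,1)$ ($m\ge1$), $\delta_m=\emptyset$ ($m\le0$); $[m]=\{1,\dots,m\}$. For $d\ge1$, the height of the prime path of row $d$ of $Y$ is $h_Y(d)=\min\{h\ge1:\lambda_{d-h}\ge\lambda_d+h\}$; the prime path of a box $B$ that is last in its row is the prime path of its row. The $B$-strip is the set of last boxes of rows $x_B-h_Y(x_B)+1,\dots,x_B$, where $x_B$ is the row of $B$; $B$ is a corner box if it is also lowest in its column. $Y'\gtrdot Y$ if $Y'$ is $Y$ with the $B$-strip of some corner box $B$ deleted. A tableau $T$ fills a Young diagram with positive integers, rows strictly increasing left to right, columns weakly increasing downward, label set exactly $[l]$, $l=l(T)$ its length; $r$-set = boxes labelled $r$; $T^{(r)}$ = boxes with labels $\le r$; the end-box of a set of boxes is its box in the row of largest index; two rows are identical if they have the same length and the same labels. A $\psi$-tableau is a tableau with $sh(T^{(r-1)})\gtrdot sh(T^{(r)})$ for all $r\in[l(T)]$. For $d\ge1$ and a tableau $T$, $\alpha_d(T)$ is obtained by moving every row of index $>d$ down one row and placing a copy of row $d$ in row $d+1$. For a tableau $Y$ of length $r$, $\beta_d(Y)$ is obtained by appending a box labelled $r+1$ at the end of each of rows $1,\dots,d$. -}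

module Defs where

open import Data.Nat using (ℕ; zero; suc; _+_; _∸_; _≤_; _<_; _≤?_)
open import Data.List using (List; []; _∷_; _++_; length; take; drop; concat; filter)
open import Data.List.Relation.Unary.All using (All)
open import Data.List.Relation.Unary.Linked using (Linked)
open import Data.List.Membership.Propositional using (_∈_; _∉_)
open import Data.Maybe using (Maybe; just; nothing)
open import Data.Product using (Σ; _×_; ∃)
open import Data.Sum using (_⊎_)
open import Data.Unit using (⊤)
open import Data.Empty using (⊥)
open import Relation.Nullary using (¬_)
open import Relation.Binary.PropositionalEquality using (_≡_; _≢_)

-- Tableaux are lists of rows (top to bottom), a row is the list of its
-- labels (left to right).  All rows of a tableau are nonempty, so the
-- representation of a tableau is canonical.

Row : Set
Row = List ℕ

Tab : Set
Tab = List Row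

-- Row i of T (1-indexed); the empty row beyond the last row (and for i = 0).
row : Tab → ℕ → Row
row [] _ = []
row (x ∷ T) zero = []
row (x ∷ T) (suc zero) = x
row (x ∷ T) (suc (suc i)) = row T (suc i)

len : Tab → ℕ → ℕ
len T i = length (row T i)

colLen : Tab → ℕ → ℕ
colLen T j = length (filter (λ x → j ≤? length x) T)

lookupM : Row → ℕ → Maybe ℕ
lookupM [] _ = nothing
lookupM (x ∷ xs) zero = just x
lookupM (x ∷ xs) (suc j) = lookupM xs j

-- Label of box (i , j) (1-indexed), nothing if there is no such box.
entry : Tab → ℕ → ℕ → Maybe ℕ
entry T i zero = nothing
entry T i (suc j) = lookupM (row T i) j

-- Column condition between consecutive rows: the lower row is not longer
-- than the upper one, and labels weakly increase downward.
ColLE : Row → Row → Set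
ColLE _ [] = ⊤
ColLE [] (b ∷ bs) = ⊥
ColLE (a ∷ as) (b ∷ bs) = (a ≤ b) × ColLE as bs

NonEmpty : Row → Set
NonEmpty x = 0 < length x

IsTableau : Tab → ℕ → Set
IsTableau T l =
  All NonEmpty T ×
  All (Linked _<_) T ×
  Linked ColLE T ×
  (∀ k → k ∈ concat T → 1 ≤ k × k ≤ l) ×
  (∀ k → 1 ≤ k → k ≤ l → k ∈ concat T)

restrict : Tab → ℕ → Tab
restrict T r = Data.List.map (filter (λ v → v ≤? r)) T

-- Young diagrams as row-length functions Y : ℕ → ℕ, Y i = λ_i for i ≥ 1
-- (the value at 0 is never used; λ_0 = +∞ is built into HCond).

Shape : Set
Shape = ℕ → ℕ

-- the condition λ_{d-h} ≥ λ_d + h, where λ_0 = +∞ (reached only at h = d)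
HCond : Shape → ℕ → ℕ → Set
HCond Y d h = (d ≤ h) ⊎ (Y d + h ≤ Y (d ∸ h))

IsHeight : Shape → ℕ → ℕ → Set
IsHeight Y d h = 1 ≤ h × HCond Y d h × (∀ h' → 1 ≤ h' → h' < h → ¬ HCond Y d h')

-- Y' ⋗ Y : Y' is Y with the B-strip of some corner box B deleted.
-- B is the last box of row x, a corner box iff λ_{x+1} < λ_x; its strip
-- consists of the last boxes of rows x-h+1, ..., x with h = h_Y(x).
Covers : Shape → Shape → Set
Covers Y' Y =
  Σ ℕ λ x → 1 ≤ x × Y (suc x) < Y x ×
  Σ ℕ λ h → IsHeight Y x h ×
  (∀ i → 1 ≤ i → (x ∸ h < i × i ≤ x) → Y' i ≡ Y i ∸ 1) ×
  (∀ i → 1 ≤ i → ¬ (x ∸ h < i × i ≤ x) → Y' i ≡ Y i)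

IsPsi : Tab → ℕ → Set
IsPsi T l =
  IsTableau T l ×
  (∀ r → 1 ≤ r → r ≤ l → Covers (len (restrict T (r ∸ 1))) (len (restrict T r)))

InDelta : ℕ → Tab → Set
InDelta m T = ∀ i → 1 ≤ i → len T i ≤ suc m ∸ i

-- α_d and β_d.  Tableaux are padded with empty rows where needed and
-- trailing empty rows are removed at the end.

padTo : ℕ → Tab → Tab
padTo zero T = T
padTo (suc k) [] = [] ∷ padTo k []
padTo (suc k) (x ∷ T) = x ∷ padTo k T

consT : Row → Tab → Tab
consT [] [] = []
consT (a ∷ as) [] = (a ∷ as) ∷ []
consT x (y ∷ T) = x ∷ y ∷ T

trim : Tab → Tab
trim [] = []
trim (x ∷ T) = consT x (trim T)

α : ℕ → Tab → Tab
α d T = trim (take d (padTo d T) ++ (row T d ∷ drop d (padTo d T)))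

appendFirst : ℕ → ℕ → Tab → Tab
appendFirst zero v T = T
appendFirst (suc k) v [] = []
appendFirst (suc k) v (x ∷ T) = (x ++ (v ∷ [])) ∷ appendFirst k v T

β : ℕ → ℕ → Tab → Tab
β d r T = trim (appendFirst d (suc r) (padTo d T))

InX : ℕ → ℕ → ℕ → Tab → Set
InX r d n X =
  IsPsi X r ×
  InDelta (n ∸ 1) X ×
  len X d ≡ n ∸ d ×
  IsHeight (len X) d d

InZ : ℕ → ℕ → ℕ → Tab → Set
InZ r d n Z =
  IsPsi Z (suc r) ×
  InDelta n Z ×
  row (restrict Z r) d ≡ row (restrict Z r) (suc d) ×
  (entry Z d (suc (n ∸ d)) ≡ just (suc r) × (∀ i → d < i → suc r ∉ row Z i)) ×
  IsHeight (len Z) d d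

-- On shapes, α_d is Y ↦ Y ∘ predAbove d.  When the prime path of row d reaches the top row,
-- α_d commutes with deleting strips: Y' ⋗ Y iff α_d Y' ⋗ α_d Y.  The reason is that prime paths
-- do not cross: a path starting below row d that climbs past it must itself reach the top, so in
-- α_d Y it becomes the path of the row one lower, one box longer.  Hence the ψ-chain of X lifts to
-- the first r steps of a ψ-chain for Z = β_d (α_d X), and β_d adds a last step whose strip is
-- rows 1, …, d.  Conversely, in Z ∈ ℤ the (r+1)-set must be that strip (its end-box is in row d
-- and the path of row d reaches the top), so removing it and the duplicated row d + 1 gives the
-- unique preimage.
module Submission where

open import Defs
open import Data.Nat using (ℕ; zero; suc; pred; _+_; _∸_; _≤_; _<_; _≤?_; _<?_; z≤n; s≤s; s≤s⁻¹; >-nonZero)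
open import Data.Nat.Properties
open import Data.List using ([]; _∷_; _++_; _∷ʳ_; length; take; drop; concat; filter; map)
open import Data.List.Properties using (length-++; filter-++; filter-all; filter-none; filter-accept; filter-reject; take++drop≡id; ∷ʳ-injectiveˡ; ++-identityʳ)
open import Data.List.Relation.Unary.All as All using (All; []; _∷_)
open import Data.List.Relation.Unary.Linked as Linked using (Linked; []; [-]; _∷_)
open import Data.List.Relation.Unary.Linked.Properties using (Linked⇒All) renaming (filter⁺ to Linked-filter⁺)
open import Data.List.Relation.Unary.Any using (here; there)
open import Data.List.Membership.Propositional using (_∈_; _∉_)
open import Data.List.Membership.Propositional.Properties using (∈-++⁻; ∈-++⁺ˡ; ∈-++⁺ʳ; ∈-filter⁻; ∈-filter⁺)
open import Data.Maybe using (just)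
open import Data.Product using (Σ; _×_; _,_; proj₁; proj₂)
open import Data.Sum using (_⊎_; inj₁; inj₂)
open import Data.Empty using (⊥-elim)
open import Data.Unit using (tt)
open import Function using (_∘_; id)
open import Function.Bundles using (_⇔_; mk⇔; Equivalence)
open import Relation.Nullary using (¬_; yes; no; Dec)
open import Relation.Binary.PropositionalEquality using (_≡_; refl; sym; trans; cong; subst; subst₂; module ≡-Reasoning)
open import Relation.Binary.Definitions using (tri<; tri≈; tri>)

open Equivalence using (to; from)

-- Row index shifts

predAbove : ℕ → ℕ → ℕ
predAbove d i with i ≤? d
... | yes _ = i
... | no _ = pred i

sucAbove : ℕ → ℕ → ℕ
sucAbove d i with i ≤? d
... | yes _ = i
... | no _ = suc i

predAbove-≤ : ∀ {d i} → i ≤ d → predAbove d i ≡ i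
predAbove-≤ {d} {i} i≤d with i ≤? d
... | yes _ = refl
... | no i≰d = ⊥-elim (i≰d i≤d)

predAbove-> : ∀ {d i} → d < i → predAbove d i ≡ pred i
predAbove-> {d} {i} d<i with i ≤? d
... | yes i≤d = ⊥-elim (<⇒≱ d<i i≤d)
... | no _ = refl

predAbove-suc : ∀ {d x} → d ≤ x → predAbove d (suc x) ≡ x
predAbove-suc d≤x = predAbove-> (s≤s d≤x)

sucAbove-≤ : ∀ {d i} → i ≤ d → sucAbove d i ≡ i
sucAbove-≤ {d} {i} i≤d with i ≤? d
... | yes _ = refl
... | no i≰d = ⊥-elim (i≰d i≤d)

sucAbove-> : ∀ {d i} → d < i → sucAbove d i ≡ suc i
sucAbove-> {d} {i} d<i with i ≤? d
... | yes i≤d = ⊥-elim (<⇒≱ d<i i≤d)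
... | no _ = refl


PredAboveCase : ℕ → ℕ → Set
PredAboveCase d i = (i ≤ d × predAbove d i ≡ i) ⊎ (d < i × predAbove d i ≡ pred i)

predAbove-cases : ∀ d i → PredAboveCase d i
predAbove-cases d i with i ≤? d
... | yes i≤d = inj₁ (i≤d , refl)
... | no i≰d = inj₂ (≰⇒> i≰d , refl)

sucAbove-cases : ∀ d i → (i ≤ d × sucAbove d i ≡ i) ⊎ (d < i × sucAbove d i ≡ suc i)
sucAbove-cases d i with i ≤? d
... | yes i≤d = inj₁ (i≤d , refl)
... | no i≰d = inj₂ (≰⇒> i≰d , refl)

predAbove-sucAbove : ∀ d i → predAbove d (sucAbove d i) ≡ i
predAbove-sucAbove d i with sucAbove-cases d i
... | inj₁ (i≤d , eq) = trans (cong (predAbove d) eq) (predAbove-≤ i≤d)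
... | inj₂ (d<i , eq) = trans (cong (predAbove d) eq) (predAbove-suc (<⇒≤ d<i))

sucAbove-predAbove-≤ : ∀ {d i} → i ≤ d → sucAbove d (predAbove d i) ≡ i
sucAbove-predAbove-≤ i≤d = trans (cong (sucAbove _) (predAbove-≤ i≤d)) (sucAbove-≤ i≤d)

predAbove-pos : ∀ {d i} → 1 ≤ d → 1 ≤ i → 1 ≤ predAbove d i
predAbove-pos {d} {i} 1≤d 1≤i with predAbove-cases d i
... | inj₁ (_ , eq) = subst (1 ≤_) (sym eq) 1≤i
... | inj₂ (d<i , eq) = subst (1 ≤_) (sym eq) (≤-trans 1≤d (<⇒≤pred d<i))

sucAbove-pos : ∀ {d i} → 1 ≤ i → 1 ≤ sucAbove d i
sucAbove-pos {d} {i} 1≤i with sucAbove-cases d i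
... | inj₁ (_ , eq) = subst (1 ≤_) (sym eq) 1≤i
... | inj₂ (_ , eq) = subst (1 ≤_) (sym eq) (s≤s z≤n)

-- Rows of α and β

row-zero : ∀ T → row T 0 ≡ []
row-zero [] = refl
row-zero (x ∷ T) = refl

row-cong : ∀ {T U} → (∀ i → 1 ≤ i → row T i ≡ row U i) → ∀ i → row T i ≡ row U i
row-cong {T} {U} _ zero = trans (row-zero T) (sym (row-zero U))
row-cong rows (suc i) = rows (suc i) (s≤s z≤n)

row-consT : ∀ x U i → row (consT x U) i ≡ row (x ∷ U) i
row-consT [] [] zero = refl
row-consT [] [] (suc zero) = refl
row-consT [] [] (suc (suc i)) = refl
row-consT (a ∷ x) [] i = refl
row-consT [] (y ∷ U) i = refl
row-consT (a ∷ x) (y ∷ U) i = refl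

row-trim : ∀ T i → row (trim T) i ≡ row T i
row-trim [] i = refl
row-trim (x ∷ T) i = trans (row-consT x (trim T) i) (row-∷-trim i)
  where
  row-∷-trim : ∀ i → row (x ∷ trim T) i ≡ row (x ∷ T) i
  row-∷-trim zero = refl
  row-∷-trim (suc zero) = refl
  row-∷-trim (suc (suc i)) = row-trim T (suc i)

row-padTo : ∀ k T i → row (padTo k T) i ≡ row T i
row-padTo zero T i = refl
row-padTo (suc k) [] zero = refl
row-padTo (suc k) [] (suc zero) = refl
row-padTo (suc k) [] (suc (suc i)) = row-padTo k [] (suc i)
row-padTo (suc k) (x ∷ T) zero = refl
row-padTo (suc k) (x ∷ T) (suc zero) = refl
row-padTo (suc k) (x ∷ T) (suc (suc i)) = row-padTo k T (suc i)

row-map : ∀ (f : Row → Row) → f [] ≡ [] → ∀ T i → row (map f T) i ≡ f (row T i)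
row-map f f[] [] i = sym f[]
row-map f f[] (x ∷ T) zero = sym f[]
row-map f f[] (x ∷ T) (suc zero) = refl
row-map f f[] (x ∷ T) (suc (suc i)) = row-map f f[] T (suc i)

restrictRow : ℕ → Row → Row
restrictRow r = filter (λ v → v ≤? r)

row-restrict : ∀ T r i → row (restrict T r) i ≡ restrictRow r (row T i)
row-restrict T r = row-map (restrictRow r) refl T

-- α d T is trim (insertRow d (row T d) T) on the nose.
insertRow : ℕ → Row → Tab → Tab
insertRow d x T = take d (padTo d T) ++ (x ∷ drop d (padTo d T))

row-insertRow-≤ : ∀ d x T i → i ≤ d → row (insertRow d x T) i ≡ row T i
row-insertRow-≤ zero x T zero _ = sym (row-zero T)
row-insertRow-≤ (suc d) x [] zero _ = refl
row-insertRow-≤ (suc d) x [] (suc zero) _ = refl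
row-insertRow-≤ (suc d) x [] (suc (suc i)) (s≤s i<d) = row-insertRow-≤ d x [] (suc i) i<d
row-insertRow-≤ (suc d) x (y ∷ T) zero _ = refl
row-insertRow-≤ (suc d) x (y ∷ T) (suc zero) _ = refl
row-insertRow-≤ (suc d) x (y ∷ T) (suc (suc i)) (s≤s i<d) = row-insertRow-≤ d x T (suc i) i<d

row-insertRow-suc : ∀ d x T → row (insertRow d x T) (suc d) ≡ x
row-insertRow-suc zero x T = refl
row-insertRow-suc (suc d) x [] = row-insertRow-suc d x []
row-insertRow-suc (suc d) x (y ∷ T) = row-insertRow-suc d x T

row-insertRow-> : ∀ d x T i → suc d < i → row (insertRow d x T) i ≡ row T (pred i)
row-insertRow-> zero x T (suc zero) (s≤s ())
row-insertRow-> zero x T (suc (suc i)) _ = refl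
row-insertRow-> (suc d) x T (suc (suc zero)) (s≤s (s≤s ()))
row-insertRow-> (suc d) x [] (suc (suc (suc i))) (s≤s d<i) = row-insertRow-> d x [] (suc (suc i)) d<i
row-insertRow-> (suc d) x (y ∷ T) (suc (suc (suc i))) (s≤s d<i) = row-insertRow-> d x T (suc (suc i)) d<i

row-α : ∀ d T i → row (α d T) i ≡ row T (predAbove d i)
row-α d T i = trans (row-trim (insertRow d (row T d) T) i) (row-insertRow i (predAbove-cases d i))
  where
  row-insertRow : ∀ i → PredAboveCase d i →
                  row (insertRow d (row T d) T) i ≡ row T (predAbove d i)
  row-insertRow i (inj₁ (i≤d , eq)) = trans (row-insertRow-≤ d (row T d) T i i≤d) (cong (row T) (sym eq))
  row-insertRow i (inj₂ (d<i , eq)) with m≤n⇒m<n∨m≡n d<i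
  ... | inj₁ 1+d<i = trans (row-insertRow-> d (row T d) T i 1+d<i) (cong (row T) (sym eq))
  ... | inj₂ refl = trans (row-insertRow-suc d (row T d) T) (cong (row T) (sym eq))

row-appendFirst-≤ : ∀ k v T i → 1 ≤ i → i ≤ k → row (appendFirst k v (padTo k T)) i ≡ row T i ∷ʳ v
row-appendFirst-≤ (suc k) v [] (suc zero) _ _ = refl
row-appendFirst-≤ (suc k) v [] (suc (suc i)) _ (s≤s i<k) = row-appendFirst-≤ k v [] (suc i) (s≤s z≤n) i<k
row-appendFirst-≤ (suc k) v (y ∷ T) (suc zero) _ _ = refl
row-appendFirst-≤ (suc k) v (y ∷ T) (suc (suc i)) _ (s≤s i<k) = row-appendFirst-≤ k v T (suc i) (s≤s z≤n) i<k

row-appendFirst-> : ∀ k v T i → k < i → row (appendFirst k v (padTo k T)) i ≡ row T i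
row-appendFirst-> zero v T i _ = refl
row-appendFirst-> (suc k) v [] (suc (suc i)) (s≤s k<i) = row-appendFirst-> k v [] (suc i) k<i
row-appendFirst-> (suc k) v (y ∷ T) (suc (suc i)) (s≤s k<i) = row-appendFirst-> k v T (suc i) k<i

row-β-≤ : ∀ d r T i → 1 ≤ i → i ≤ d → row (β d r T) i ≡ row T i ∷ʳ suc r
row-β-≤ d r T i 1≤i i≤d = trans (row-trim (appendFirst d (suc r) (padTo d T)) i) (row-appendFirst-≤ d (suc r) T i 1≤i i≤d)

row-β-> : ∀ d r T i → d < i → row (β d r T) i ≡ row T i
row-β-> d r T i d<i = trans (row-trim (appendFirst d (suc r) (padTo d T)) i) (row-appendFirst-> d (suc r) T i d<i)

-- Prime paths under row duplication

αShape : ℕ → Shape → Shape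
αShape d Y i = Y (predAbove d i)

HCond-transport : ∀ {Y Y₂ : Shape} {a b g} → ¬ a ≤ g →
                  Y₂ b ≡ Y a → Y₂ (b ∸ g) ≡ Y (a ∸ g) → HCond Y a g → HCond Y₂ b g
HCond-transport a≰g _ _ (inj₁ a≤g) = ⊥-elim (a≰g a≤g)
HCond-transport {g = g} _ eq eq' (inj₂ ineq) = inj₂ (subst₂ (λ u v → u + g ≤ v) (sym eq) (sym eq') ineq)

HCond-resp : ∀ {Y Y₂ : Shape} {x g} → (∀ i → i ≤ x → Y₂ i ≡ Y i) → HCond Y x g → HCond Y₂ x g
HCond-resp _ (inj₁ x≤g) = inj₁ x≤g
HCond-resp {x = x} {g} eq (inj₂ ineq) = inj₂ (subst₂ (λ u v → u + g ≤ v) (sym (eq x ≤-refl)) (sym (eq (x ∸ g) (m∸n≤m x g))) ineq)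

HCond? : ∀ Y x g → Dec (HCond Y x g)
HCond? Y x g with x ≤? g | Y x + g ≤? Y (x ∸ g)
... | yes x≤g | _ = yes (inj₁ x≤g)
... | no _ | yes ineq = yes (inj₂ ineq)
... | no x≰g | no ¬ineq = no λ { (inj₁ x≤g) → x≰g x≤g ; (inj₂ ineq) → ¬ineq ineq }

IsHeight-unique : ∀ {Y x h h'} → IsHeight Y x h → IsHeight Y x h' → h ≡ h'
IsHeight-unique {h = h} {h'} (1≤h , cond , minimal) (1≤h' , cond' , minimal') with <-cmp h h'
... | tri< h<h' _ _ = ⊥-elim (minimal' h 1≤h h<h' cond)
... | tri≈ _ h≡h' _ = h≡h'
... | tri> _ _ h'<h = ⊥-elim (minimal h' 1≤h' h'<h cond')

height : ∀ Y x → Σ ℕ (IsHeight Y x)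
height Y x = search x 1 (m≤m+n x 1) (s≤s z≤n) (λ g 1≤g g<1 _ → <⇒≱ g<1 1≤g)
  where
  search : ∀ fuel s → x ≤ fuel + s → 1 ≤ s → (∀ g → 1 ≤ g → g < s → ¬ HCond Y x g) → Σ ℕ (IsHeight Y x)
  search fuel s x≤ 1≤s below with HCond? Y x s
  ... | yes cond = s , 1≤s , cond , below
  search zero s x≤ 1≤s below | no ¬cond = ⊥-elim (¬cond (inj₁ x≤))
  search (suc fuel) s x≤ 1≤s below | no ¬cond =
    search fuel (suc s) (subst (x ≤_) (sym (+-suc fuel s)) x≤) (m≤n⇒m≤1+n 1≤s) below'
    where
    below' : ∀ g → 1 ≤ g → g < suc s → ¬ HCond Y x g
    below' g 1≤g g<1+s with m≤n⇒m<n∨m≡n (s≤s⁻¹ g<1+s)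
    ... | inj₁ g<s = below g 1≤g g<s
    ... | inj₂ refl = ¬cond

IsHeight-≤ : ∀ {Y x h} → 1 ≤ x → IsHeight Y x h → h ≤ x
IsHeight-≤ {x = x} {h} 1≤x (_ , _ , minimal) with x <? h
... | yes x<h = ⊥-elim (minimal x 1≤x x<h (inj₁ ≤-refl))
... | no x≮h = ≮⇒≥ x≮h

IsHeight-resp : ∀ {Y Y₂ : Shape} {x h} → (∀ i → i ≤ x → Y₂ i ≡ Y i) → IsHeight Y x h → IsHeight Y₂ x h
IsHeight-resp eq (1≤h , cond , minimal) =
  1≤h , HCond-resp eq cond , λ g 1≤g g<h cond' → minimal g 1≤g g<h (HCond-resp (λ i i≤x → sym (eq i i≤x)) cond')

-- The prime path of row d has height d, i.e. it climbs to the top row.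
ReachesTop : ℕ → Shape → Set
ReachesTop d Y = ∀ g → 1 ≤ g → g < d → ¬ HCond Y d g

reachesTop⇒IsHeight : ∀ {d Y} → 1 ≤ d → ReachesTop d Y → IsHeight Y d d
reachesTop⇒IsHeight 1≤d top = 1≤d , inj₁ ≤-refl , top

IsHeight⇒reachesTop : ∀ {d Y} → IsHeight Y d d → ReachesTop d Y
IsHeight⇒reachesTop (_ , _ , minimal) = minimal

reachesTop-resp : ∀ {d Y Y₂} → (∀ i → i ≤ d → Y₂ i ≡ Y i) → ReachesTop d Y → ReachesTop d Y₂
reachesTop-resp eq top g 1≤g g<d cond = top g 1≤g g<d (HCond-resp (λ i i≤d → sym (eq i i≤d)) cond)

-- Prime paths do not cross.  Otherwise, with a = x ∸ d and b = d ∸ (x ∸ h), minimality of h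
-- (at a) and the path of row d (at b) give Y x + a + b ≤ Y (x ∸ h) < Y d + b < Y x + a + b.
passing-height≡row : ∀ {d Y x h} → 1 ≤ d → ReachesTop d Y → d ≤ x → IsHeight Y x h → x < d + h → h ≡ x
passing-height≡row {d} {Y} {x} {h} 1≤d top d≤x H@(1≤h , cond , minimal) x<d+h
  with m≤n⇒m<n∨m≡n (IsHeight-≤ {Y} (≤-trans 1≤d d≤x) H)
... | inj₂ h≡x = h≡x
... | inj₁ h<x with cond
...   | inj₁ x≤h = ⊥-elim (<⇒≱ h<x x≤h)
...   | inj₂ ineq with m≤n⇒m<n∨m≡n d≤x
...     | inj₂ refl = ⊥-elim (top h 1≤h h<x (inj₂ ineq))
...     | inj₁ d<x = ⊥-elim (<-irrefl refl impossible)
  where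
  open ≤-Reasoning
  a : ℕ
  a = x ∸ d
  e : ℕ
  e = x ∸ h
  b : ℕ
  b = d ∸ e
  e<d : e < d
  e<d = m<n+o⇒m∸n<o x h {{>-nonZero 1≤d}} (subst (x <_) (+-comm d h) x<d+h)
  h≡a+b : h ≡ a + b
  h≡a+b = +-cancelʳ-≡ e h (a + b) (begin-equality
    h + e        ≡⟨ +-comm h e ⟩
    e + h        ≡⟨ m∸n+n≡m (<⇒≤ h<x) ⟩
    x            ≡⟨ m∸n+n≡m d≤x ⟨
    a + d        ≡⟨ cong (a +_) (m∸n+n≡m (<⇒≤ e<d)) ⟨
    a + (b + e)  ≡⟨ +-assoc a b e ⟨
    a + b + e    ∎)
  Yd<Yx+a : Y d < Y x + a
  Yd<Yx+a = ≰⇒> λ le → minimal a (m<n⇒0<n∸m d<x) (m<n+o⇒m∸n<o x d {{>-nonZero 1≤h}} x<d+h)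
                         (inj₂ (subst (λ z → Y x + a ≤ Y z) (sym (m∸[m∸n]≡n d≤x)) le))
  Ye<Yd+b : Y e < Y d + b
  Ye<Yd+b = ≰⇒> λ le → top b (m<n⇒0<n∸m e<d) (∸-monoʳ-< {d} {e} {0} (m<n⇒0<n∸m h<x) (<⇒≤ e<d))
                         (inj₂ (subst (λ z → Y d + b ≤ Y z) (sym (m∸[m∸n]≡n (<⇒≤ e<d))) le))
  impossible : Y x + (a + b) < Y x + (a + b)
  impossible = begin-strict
    Y x + (a + b)  ≤⟨ subst (λ z → Y x + z ≤ Y e) h≡a+b ineq ⟩
    Y e            <⟨ Ye<Yd+b ⟩
    Y d + b        <⟨ +-monoˡ-< b Yd<Yx+a ⟩
    Y x + a + b    ≡⟨ +-assoc (Y x) a b ⟩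
    Y x + (a + b)  ∎

αShape-≤ : ∀ {d i} (Y : Shape) → i ≤ d → αShape d Y i ≡ Y i
αShape-≤ Y i≤d = cong Y (predAbove-≤ i≤d)

αShape-suc : ∀ {d x} (Y : Shape) → d ≤ x → αShape d Y (suc x) ≡ Y x
αShape-suc Y d≤x = cong Y (predAbove-suc d≤x)

IsHeight-αShape-below : ∀ {d Y x h} → x ≤ d → IsHeight Y x h ⇔ IsHeight (αShape d Y) x h
IsHeight-αShape-below {Y = Y} x≤d =
  mk⇔ (IsHeight-resp (λ i i≤x → αShape-≤ Y (≤-trans i≤x x≤d)))
      (IsHeight-resp (λ i i≤x → sym (αShape-≤ Y (≤-trans i≤x x≤d))))

HCond-αShape-low : ∀ {d Y x g} → 1 ≤ d → d + g ≤ x → HCond Y x g ⇔ HCond (αShape d Y) (suc x) g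
HCond-αShape-low {d} {Y} {x} {g} 1≤d d+g≤x =
  mk⇔ (HCond-transport {Y} {αShape d Y} (<⇒≱ g<x) top-row (sym shifted-row))
      (HCond-transport {αShape d Y} {Y} (<⇒≱ (m≤n⇒m≤1+n g<x)) (sym top-row) shifted-row)
  where
  g<x : g < x
  g<x = ≤-trans (+-monoˡ-≤ g 1≤d) d+g≤x
  d≤x∸g : d ≤ x ∸ g
  d≤x∸g = subst (_≤ x ∸ g) (m+n∸n≡m d g) (∸-monoˡ-≤ g d+g≤x)
  top-row : αShape d Y (suc x) ≡ Y x
  top-row = αShape-suc Y (≤-trans (m≤m+n d g) d+g≤x)
  shifted-row : Y (x ∸ g) ≡ αShape d Y (suc x ∸ g)
  shifted-row = sym (trans (cong (αShape d Y) (+-∸-assoc 1 (<⇒≤ g<x))) (αShape-suc Y d≤x∸g))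

IsHeight-αShape-low : ∀ {d Y x h} → 1 ≤ d → d + h ≤ x → IsHeight Y x h → IsHeight (αShape d Y) (suc x) h
IsHeight-αShape-low {Y = Y} 1≤d d+h≤x (1≤h , cond , minimal) =
  1≤h , to (HCond-αShape-low {Y = Y} 1≤d d+h≤x) cond ,
  λ g 1≤g g<h cond' → minimal g 1≤g g<h (from (HCond-αShape-low {Y = Y} 1≤d (≤-trans (+-monoʳ-≤ _ (<⇒≤ g<h)) d+h≤x)) cond')

IsHeight-αShape-high : ∀ {d Y x} → 1 ≤ d → d ≤ x → IsHeight Y x x → IsHeight (αShape d Y) (suc x) (suc x)
IsHeight-αShape-high {d} {Y} {x} 1≤d d≤x (_ , _ , minimal) = s≤s z≤n , inj₁ ≤-refl , minimal'
  where
  minimal' : ∀ g → 1 ≤ g → g < suc x → ¬ HCond (αShape d Y) (suc x) g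
  minimal' g 1≤g g≤x cond with d + g ≤? x
  ... | yes d+g≤x = minimal g 1≤g (≤-trans (+-monoˡ-≤ g 1≤d) d+g≤x) (from (HCond-αShape-low {Y = Y} 1≤d d+g≤x) cond)
  minimal' (suc g) _ g<x (inj₁ x≤g) | no _ = <⇒≱ (s≤s⁻¹ g<x) (s≤s⁻¹ x≤g)
  minimal' (suc g) _ g<x (inj₂ ineq) | no d+g≰x = no-step g (s≤s⁻¹ g<x) ineq'
    where
    x∸g≤d : x ∸ g ≤ d
    x∸g≤d = m≤n+o⇒m∸n≤o x g (subst (x ≤_) (+-comm d g) (s≤s⁻¹ (subst (suc x ≤_) (+-suc d g) (≰⇒> d+g≰x))))
    ineq' : Y x + suc g ≤ Y (x ∸ g)
    ineq' = subst₂ (λ u v → u + suc g ≤ v) (αShape-suc Y d≤x) (αShape-≤ Y x∸g≤d) ineq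
    no-step : ∀ g → g < x → ¬ Y x + suc g ≤ Y (x ∸ g)
    no-step zero _ le = <-irrefl refl (subst (_≤ Y x) (+-comm (Y x) 1) le)
    no-step (suc g) g<x le = minimal (suc g) (s≤s z≤n) g<x (inj₂ (≤-trans (+-monoʳ-≤ (Y x) (n≤1+n (suc g))) le))

InStrip : ℕ → ℕ → ℕ → Set
InStrip x h i = x ∸ h < i × i ≤ x

InStrip? : ∀ x h i → Dec (InStrip x h i)
InStrip? x h i with x ∸ h <? i | i ≤? x
... | yes lower | yes upper = yes (lower , upper)
... | no ¬lower | _ = no (¬lower ∘ proj₁)
... | yes _ | no ¬upper = no (¬upper ∘ proj₂)

InStrip-top : ∀ {x i} → 1 ≤ i → i ≤ x → InStrip x x i
InStrip-top {x} {i} 1≤i i≤x = subst (_< i) (sym (n∸n≡0 x)) 1≤i , i≤x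

-- The last two components of Covers Y' Y at corner row x with strip height h.
StripRemoved : Shape → Shape → ℕ → ℕ → Set
StripRemoved Y' Y x h =
  (∀ i → 1 ≤ i → InStrip x h i → Y' i ≡ Y i ∸ 1) × (∀ i → 1 ≤ i → ¬ InStrip x h i → Y' i ≡ Y i)

StripRemoved-reindex : ∀ {Y' Y : Shape} {x h x₂ h₂} (f : ℕ → ℕ) → (∀ i → 1 ≤ i → 1 ≤ f i) →
                       (∀ i → 1 ≤ i → InStrip x₂ h₂ i ⇔ InStrip x h (f i)) →
                       StripRemoved Y' Y x h → StripRemoved (Y' ∘ f) (Y ∘ f) x₂ h₂
StripRemoved-reindex f f-pos strip (inside , outside) =
  (λ i 1≤i i∈ → inside (f i) (f-pos i 1≤i) (to (strip i 1≤i) i∈)) ,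
  (λ i 1≤i i∉ → outside (f i) (f-pos i 1≤i) (i∉ ∘ from (strip i 1≤i)))

StripRemoved-resp : ∀ {Y' Y Y₂' Y₂ : Shape} {x h} → (∀ i → Y₂' i ≡ Y' i) → (∀ i → Y₂ i ≡ Y i) →
                    StripRemoved Y' Y x h → StripRemoved Y₂' Y₂ x h
StripRemoved-resp eq' eq (inside , outside) =
  (λ i 1≤i i∈ → trans (eq' i) (trans (inside i 1≤i i∈) (cong (_∸ 1) (sym (eq i))))) ,
  (λ i 1≤i i∉ → trans (eq' i) (trans (outside i 1≤i i∉) (sym (eq i))))

Covers-resp : ∀ {Y' Y Y₂' Y₂ : Shape} → (∀ i → Y₂' i ≡ Y' i) → (∀ i → Y₂ i ≡ Y i) → Covers Y' Y → Covers Y₂' Y₂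
Covers-resp eq' eq (x , 1≤x , corner , h , H , removed) =
  x , 1≤x , subst₂ _<_ (sym (eq (suc x))) (sym (eq x)) corner , h ,
  IsHeight-resp (λ i _ → eq i) H , StripRemoved-resp {x = x} {h} eq' eq removed

-- How a corner x of Y with strip height h reappears, as x' with height h', in αShape d Y.
record StripLift (d : ℕ) (Y : Shape) (x h x' h' : ℕ) : Set where
  field
    source : predAbove d x' ≡ x
    source-suc : predAbove d (suc x') ≡ suc x
    lifted-height : IsHeight (αShape d Y) x' h'
    strip-source : ∀ i → 1 ≤ i → InStrip x' h' i ⇔ InStrip x h (predAbove d i)

stripLift-below : ∀ {d Y x h} → x < d → IsHeight Y x h → StripLift d Y x h x h
stripLift-below {d} {Y} {x} {h} x<d H = record
  { source = predAbove-≤ (<⇒≤ x<d)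
  ; source-suc = predAbove-≤ x<d
  ; lifted-height = to (IsHeight-αShape-below {Y = Y} (<⇒≤ x<d)) H
  ; strip-source = λ i _ → mk⇔ (to-source i) (from-source i (predAbove-cases d i))
  }
  where
  to-source : ∀ i → InStrip x h i → InStrip x h (predAbove d i)
  to-source i i∈@(_ , i≤x) = subst (InStrip x h) (sym (predAbove-≤ (≤-trans i≤x (<⇒≤ x<d)))) i∈
  from-source : ∀ i → PredAboveCase d i →
                InStrip x h (predAbove d i) → InStrip x h i
  from-source i (inj₁ (_ , eq)) i∈ = subst (InStrip x h) eq i∈
  from-source i (inj₂ (d<i , eq)) (_ , i≤x) = ⊥-elim (<⇒≱ x<d (≤-trans (<⇒≤pred d<i) (subst (_≤ x) eq i≤x)))

stripLift-low : ∀ {d Y x h} → 1 ≤ d → d + h ≤ x → IsHeight Y x h → StripLift d Y x h (suc x) h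
stripLift-low {d} {Y} {x} {h} 1≤d d+h≤x H = record
  { source = predAbove-suc d≤x
  ; source-suc = predAbove-suc (m≤n⇒m≤1+n d≤x)
  ; lifted-height = IsHeight-αShape-low {Y = Y} 1≤d d+h≤x H
  ; strip-source = λ { (suc j) _ → mk⇔ (to-source j) (from-source j (predAbove-cases d (suc j))) }
  }
  where
  d≤x : d ≤ x
  d≤x = ≤-trans (m≤m+n d h) d+h≤x
  d≤x∸h : d ≤ x ∸ h
  d≤x∸h = subst (_≤ x ∸ h) (m+n∸n≡m d h) (∸-monoˡ-≤ h d+h≤x)
  suc-x∸h : suc x ∸ h ≡ suc (x ∸ h)
  suc-x∸h = +-∸-assoc 1 (≤-trans (m≤n+m h d) d+h≤x)
  to-source : ∀ j → InStrip (suc x) h (suc j) → InStrip x h (predAbove d (suc j))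
  to-source j (lower , upper) = subst (InStrip x h) (sym (predAbove-suc (≤-trans d≤x∸h (<⇒≤ lower'))))
                                      (lower' , s≤s⁻¹ upper)
    where
    lower' : x ∸ h < j
    lower' = s≤s⁻¹ (subst (_< suc j) suc-x∸h lower)
  from-source : ∀ j → PredAboveCase d (suc j) →
                InStrip x h (predAbove d (suc j)) → InStrip (suc x) h (suc j)
  from-source j (inj₁ (j<d , eq)) (lower , _) = ⊥-elim (<⇒≱ (subst (x ∸ h <_) eq lower) (≤-trans j<d d≤x∸h))
  from-source j (inj₂ (_ , eq)) (lower , upper) =
    subst (_< suc j) (sym suc-x∸h) (s≤s (subst (x ∸ h <_) eq lower)) , s≤s (subst (_≤ x) eq upper)

stripLift-high : ∀ {d Y x} → 1 ≤ d → d ≤ x → IsHeight Y x x → StripLift d Y x x (suc x) (suc x)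
stripLift-high {d} {Y} {x} 1≤d d≤x H = record
  { source = predAbove-suc d≤x
  ; source-suc = predAbove-suc (m≤n⇒m≤1+n d≤x)
  ; lifted-height = IsHeight-αShape-high {Y = Y} 1≤d d≤x H
  ; strip-source = λ i 1≤i → mk⇔ (to-source i 1≤i (predAbove-cases d i)) (from-source i 1≤i (predAbove-cases d i))
  }
  where
  to-source : ∀ i → 1 ≤ i → PredAboveCase d i →
              InStrip (suc x) (suc x) i → InStrip x x (predAbove d i)
  to-source i 1≤i (inj₁ (i≤d , eq)) _ = subst (InStrip x x) (sym eq) (InStrip-top 1≤i (≤-trans i≤d d≤x))
  to-source i 1≤i (inj₂ (d<i , eq)) (_ , i≤1+x) =
    subst (InStrip x x) (sym eq) (InStrip-top (≤-trans 1≤d (<⇒≤pred d<i)) (pred-mono-≤ i≤1+x))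
  from-source : ∀ i → 1 ≤ i → PredAboveCase d i →
                InStrip x x (predAbove d i) → InStrip (suc x) (suc x) i
  from-source (suc j) _ (inj₁ (i≤d , _)) _ = InStrip-top (s≤s z≤n) (≤-trans i≤d (m≤n⇒m≤1+n d≤x))
  from-source (suc j) _ (inj₂ (_ , eq)) (_ , j≤x) = InStrip-top (s≤s z≤n) (s≤s (subst (_≤ x) eq j≤x))

stripLift-above : ∀ {d Y x h} → 1 ≤ d → ReachesTop d Y → d ≤ x → IsHeight Y x h → Σ ℕ (StripLift d Y x h (suc x))
stripLift-above {d} {Y} {x} {h} 1≤d top d≤x H with d + h ≤? x
... | yes d+h≤x = h , stripLift-low 1≤d d+h≤x H
... | no d+h≰x with passing-height≡row {Y = Y} 1≤d top d≤x H (≰⇒> d+h≰x)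
...   | refl = suc x , stripLift-high 1≤d d≤x H

StripLift-covers : ∀ {d Y Y' x h x' h'} → 1 ≤ d → 1 ≤ x' → StripLift d Y x h x' h' →
                   Y (suc x) < Y x → StripRemoved Y' Y x h → Covers (αShape d Y') (αShape d Y)
StripLift-covers {d} {Y} {x = x} {h} {x'} {h'} 1≤d 1≤x' L corner removed =
  x' , 1≤x' , subst₂ _<_ (cong Y (sym source-suc)) (cong Y (sym source)) corner , h' , lifted-height ,
  StripRemoved-reindex {x = x} {h} {x'} {h'} (predAbove d) (λ _ → predAbove-pos 1≤d) strip-source removed
  where open StripLift L

StripLift-covered : ∀ {d Y Y' x h x' h' h''} → 1 ≤ x → IsHeight Y x h → StripLift d Y x h x' h' →
                    αShape d Y (suc x') < αShape d Y x' → IsHeight (αShape d Y) x' h'' →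
                    StripRemoved (αShape d Y') (αShape d Y) x' h'' → Covers Y' Y
StripLift-covered {d} {Y} {Y'} {x} {h} {x'} {h'} 1≤x H L corner H'' removed with IsHeight-unique {αShape d Y} lifted-height H''
  where open StripLift L
... | refl = x , 1≤x , subst₂ _<_ (cong Y source-suc) (cong Y source) corner , h , H ,
             StripRemoved-resp {x = x} {h} (λ i → cong Y' (sym (predAbove-sucAbove d i))) (λ i → cong Y (sym (predAbove-sucAbove d i)))
               (StripRemoved-reindex {x = x'} {h'} {x} {h} (sucAbove d) (λ _ → sucAbove-pos) strip-target removed)
  where
  open StripLift L
  strip-target : ∀ i → 1 ≤ i → InStrip x h i ⇔ InStrip x' h' (sucAbove d i)
  strip-target i 1≤i = mk⇔ (from iff ∘ subst (InStrip x h) (sym (predAbove-sucAbove d i)))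
                           (subst (InStrip x h) (predAbove-sucAbove d i) ∘ to iff)
    where
    iff : InStrip x' h' (sucAbove d i) ⇔ InStrip x h (predAbove d (sucAbove d i))
    iff = strip-source (sucAbove d i) (sucAbove-pos 1≤i)

covers-αShape : ∀ {d Y Y'} → 1 ≤ d → ReachesTop d Y → Covers Y' Y → Covers (αShape d Y') (αShape d Y)
covers-αShape {d} {Y} 1≤d top (x , 1≤x , corner , h , H , removed) with x <? d
... | yes x<d = StripLift-covers 1≤d 1≤x (stripLift-below x<d H) corner removed
... | no x≮d = StripLift-covers 1≤d (s≤s z≤n) (proj₂ (stripLift-above 1≤d top (≮⇒≥ x≮d) H)) corner removed

covers-αShape⁻¹ : ∀ {d Y Y'} → 1 ≤ d → ReachesTop d Y → Covers (αShape d Y') (αShape d Y) → Covers Y' Y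
covers-αShape⁻¹ {d} {Y} 1≤d top (suc x , 1≤x' , corner , h'' , H'' , removed) with <-cmp (suc x) d
... | tri< x'<d _ _ = StripLift-covered 1≤x' H (stripLift-below x'<d H) corner H'' removed
  where
  H : IsHeight Y (suc x) (proj₁ (height Y (suc x)))
  H = proj₂ (height Y (suc x))
... | tri≈ _ refl _ = ⊥-elim (<-irrefl (trans (αShape-suc {d} Y ≤-refl) (sym (αShape-≤ {d} Y ≤-refl))) corner)
... | tri> _ _ d<x' = StripLift-covered (≤-trans 1≤d (s≤s⁻¹ d<x')) H
                        (proj₂ (stripLift-above 1≤d top (s≤s⁻¹ d<x') H)) corner H'' removed
  where
  H : IsHeight Y x (proj₁ (height Y x))
  H = proj₂ (height Y x)

StripRemoved-≤ : ∀ {Y' Y : Shape} {x h} → StripRemoved Y' Y x h → ∀ j → 1 ≤ j → Y' j ≤ Y j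
StripRemoved-≤ {Y = Y} {x} {h} (inside , outside) j 1≤j with InStrip? x h j
... | yes j∈ = subst (_≤ Y j) (sym (inside j 1≤j j∈)) (m∸n≤m (Y j) 1)
... | no j∉ = ≤-reflexive (outside j 1≤j j∉)

InStrip⇒<+ : ∀ {x h i} → InStrip x h i → x < i + h
InStrip⇒<+ {x} {h} {i} (x∸h<i , _) = subst (x <_) (+-comm h i) (≤-trans (s≤s (m≤n+m∸n x h)) (+-monoʳ-< h x∸h<i))

-- If row d lies in the deleted strip, that strip is the whole path of its corner (paths do not
-- cross), so rows d and d ∸ g both lose a box and the inequality survives.
reachesTop-covered : ∀ {d Y Y'} → 1 ≤ d → ReachesTop d Y → Covers Y' Y → ReachesTop d Y'
reachesTop-covered _ _ _ g _ g<d (inj₁ d≤g) = <⇒≱ g<d d≤g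
reachesTop-covered {d} {Y} {Y'} 1≤d top (x , _ , _ , h , H , removed@(inside , outside)) g 1≤g g<d (inj₂ ineq)
  with InStrip? x h d
... | no d∉ = top g 1≤g g<d (inj₂ (≤-trans (subst (λ z → z + g ≤ Y' (d ∸ g)) (outside d 1≤d d∉) ineq)
                                              (StripRemoved-≤ {x = x} {h} removed (d ∸ g) (m<n⇒0<n∸m g<d))))
... | yes d∈@(_ , d≤x) with passing-height≡row {Y = Y} 1≤d top d≤x H (InStrip⇒<+ d∈)
...   | refl = top g 1≤g g<d (inj₂ (lower-both (subst₂ (λ u v → u + g ≤ v) (inside d 1≤d d∈) (inside (d ∸ g) 1≤d∸g d∸g∈) ineq)))
  where
  1≤d∸g : 1 ≤ d ∸ g
  1≤d∸g = m<n⇒0<n∸m g<d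
  d∸g∈ : InStrip x x (d ∸ g)
  d∸g∈ = InStrip-top 1≤d∸g (≤-trans (m∸n≤m d g) d≤x)
  lower-both : ∀ {a b} → (a ∸ 1) + g ≤ b ∸ 1 → a + g ≤ b
  lower-both {zero} le = ≤-trans le (m∸n≤m _ 1)
  lower-both {suc a} {zero} le = ⊥-elim (<⇒≱ 1≤g (≤-trans (m≤n+m g a) le))
  lower-both {suc a} {suc b} le = s≤s le

reachesTop-raise : ∀ {d Y Y₂} → (∀ i → 1 ≤ i → i ≤ d → Y₂ i ≡ suc (Y i)) → ReachesTop d Y ⇔ ReachesTop d Y₂
reachesTop-raise {d} {Y} {Y₂} raised = mk⇔
  (λ top g 1≤g g<d cond → top g 1≤g g<d (to (HCond-raise 1≤g g<d) cond))
  (λ top g 1≤g g<d cond → top g 1≤g g<d (from (HCond-raise 1≤g g<d) cond))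
  where
  HCond-raise : ∀ {g} → 1 ≤ g → g < d → HCond Y₂ d g ⇔ HCond Y d g
  HCond-raise {g} 1≤g g<d = mk⇔
    (λ { (inj₁ d≤g) → inj₁ d≤g ; (inj₂ ineq) → inj₂ (s≤s⁻¹ (subst₂ (λ u v → u + g ≤ v) top-row shifted-row ineq)) })
    (λ { (inj₁ d≤g) → inj₁ d≤g ; (inj₂ ineq) → inj₂ (subst₂ (λ u v → u + g ≤ v) (sym top-row) (sym shifted-row) (s≤s ineq)) })
    where
    top-row : Y₂ d ≡ suc (Y d)
    top-row = raised d (≤-trans 1≤g (<⇒≤ g<d)) ≤-refl
    shifted-row : Y₂ (d ∸ g) ≡ suc (Y (d ∸ g))
    shifted-row = raised (d ∸ g) (m<n⇒0<n∸m g<d) (m∸n≤m d g)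

covers-raised : ∀ {d Y Ỹ} → 1 ≤ d → ReachesTop d Y → (∀ i → 1 ≤ i → i ≤ d → Ỹ i ≡ suc (Y i)) →
                (∀ i → d < i → Ỹ i ≡ αShape d Y i) → Covers (αShape d Y) Ỹ
covers-raised {d} {Y} {Ỹ} 1≤d top raised above = d , 1≤d , corner , d , height-d , inside , outside
  where
  corner : Ỹ (suc d) < Ỹ d
  corner = subst₂ _<_ (sym (trans (above (suc d) ≤-refl) (αShape-suc Y ≤-refl))) (sym (raised d 1≤d ≤-refl)) ≤-refl
  height-d : IsHeight Ỹ d d
  height-d = reachesTop⇒IsHeight {Y = Ỹ} 1≤d (to (reachesTop-raise raised) top)
  inside : ∀ i → 1 ≤ i → InStrip d d i → αShape d Y i ≡ Ỹ i ∸ 1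
  inside i 1≤i (_ , i≤d) = trans (αShape-≤ Y i≤d) (cong (_∸ 1) (sym (raised i 1≤i i≤d)))
  outside : ∀ i → 1 ≤ i → ¬ InStrip d d i → αShape d Y i ≡ Ỹ i
  outside i 1≤i i∉ with d <? i
  ... | yes d<i = sym (above i d<i)
  ... | no d≮i = ⊥-elim (i∉ (InStrip-top 1≤i (≮⇒≥ d≮i)))

reachesTop-chain : ∀ {d} r (Sh : ℕ → Shape) → 1 ≤ d → ReachesTop d (Sh r) →
                   (∀ k → 1 ≤ k → k ≤ r → ReachesTop d (Sh k) → Covers (Sh (k ∸ 1)) (Sh k)) →
                   ∀ k → k ≤ r → ReachesTop d (Sh k)
reachesTop-chain {d} r Sh 1≤d top-r covers k k≤r = down (r ∸ k) k (m∸n+n≡m k≤r)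
  where
  down : ∀ t k → t + k ≡ r → ReachesTop d (Sh k)
  down zero k refl = top-r
  down (suc t) k t+k≡r = reachesTop-covered 1≤d top-k+1 (covers (suc k) (s≤s z≤n) k<r top-k+1)
    where
    t+k+1≡r : t + suc k ≡ r
    t+k+1≡r = trans (+-suc t k) t+k≡r
    k<r : suc k ≤ r
    k<r = subst (suc k ≤_) t+k+1≡r (m≤n+m (suc k) t)
    top-k+1 : ReachesTop d (Sh (suc k))
    top-k+1 = down t (suc k) t+k+1≡r

-- Tableaux row by row

All-rows : ∀ {Q : Row → Set} T → (∀ i → 1 ≤ i → Q (row T i)) → All Q T
All-rows [] _ = []
All-rows (x ∷ T) q = q 1 (s≤s z≤n) ∷ All-rows T (λ { (suc i) _ → q (suc (suc i)) (s≤s z≤n) })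

All⇒rows : ∀ {Q : Row → Set} {T} → Q [] → All Q T → ∀ i → Q (row T i)
All⇒rows q[] [] i = q[]
All⇒rows q[] (q ∷ qs) zero = q[]
All⇒rows q[] (q ∷ qs) (suc zero) = q
All⇒rows q[] (q ∷ qs) (suc (suc i)) = All⇒rows q[] qs (suc i)

Linked-rows : ∀ {R : Row → Row → Set} T → (∀ i → 1 ≤ i → R (row T i) (row T (suc i))) → Linked R T
Linked-rows [] _ = []
Linked-rows (x ∷ []) _ = [-]
Linked-rows (x ∷ y ∷ T) R = R 1 (s≤s z≤n) ∷ Linked-rows (y ∷ T) (λ { (suc i) _ → R (suc (suc i)) (s≤s z≤n) })

ColumnsWeak : Tab → Set
ColumnsWeak T = ∀ i → 1 ≤ i → ColLE (row T i) (row T (suc i))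

Linked⇒columns : ∀ {T} → Linked ColLE T → ColumnsWeak T
Linked⇒columns [] (suc i) _ = tt
Linked⇒columns [-] (suc zero) _ = tt
Linked⇒columns [-] (suc (suc i)) _ = tt
Linked⇒columns (c ∷ cs) (suc zero) _ = c
Linked⇒columns (c ∷ cs) (suc (suc i)) _ = Linked⇒columns cs (suc i) (s≤s z≤n)

∈-concat⁻ : ∀ T {k} → k ∈ concat T → Σ ℕ λ i → 1 ≤ i × k ∈ row T i
∈-concat⁻ (x ∷ T) k∈ with ∈-++⁻ x k∈
... | inj₁ k∈x = 1 , s≤s z≤n , k∈x
... | inj₂ k∈T with ∈-concat⁻ T k∈T
...   | suc i , _ , k∈row = suc (suc i) , s≤s z≤n , k∈row

∈-concat⁺ : ∀ T {k} i → 1 ≤ i → k ∈ row T i → k ∈ concat T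
∈-concat⁺ (x ∷ T) (suc zero) _ k∈ = ∈-++⁺ˡ k∈
∈-concat⁺ (x ∷ T) (suc (suc i)) _ k∈ = ∈-++⁺ʳ x (∈-concat⁺ T (suc i) (s≤s z≤n) k∈)

ColLE-length : ∀ {x y} → ColLE x y → length y ≤ length x
ColLE-length {y = []} _ = z≤n
ColLE-length {a ∷ x} {b ∷ y} (_ , c) = s≤s (ColLE-length c)

len-antitone : ∀ {T} → ColumnsWeak T → ∀ {i j} → 1 ≤ i → i ≤ j → len T j ≤ len T i
len-antitone {T} cols {suc i} {zero} _ ()
len-antitone {T} cols {i} {suc j} 1≤i i≤j with m≤n⇒m<n∨m≡n i≤j
... | inj₂ refl = ≤-refl
... | inj₁ i<j = ≤-trans (ColLE-length (cols j (≤-trans 1≤i (s≤s⁻¹ i<j)))) (len-antitone {T} cols 1≤i (s≤s⁻¹ i<j))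

rows-empty-below : ∀ T → ColumnsWeak T → row T 1 ≡ [] → ∀ i → row T i ≡ []
rows-empty-below T _ _ zero = row-zero T
rows-empty-below T _ empty (suc zero) = empty
rows-empty-below T cols empty (suc (suc i)) = ColLE-[] (subst (λ x → ColLE x (row T (suc (suc i)))) (rows-empty-below T cols empty (suc i)) (cols (suc i) (s≤s z≤n)))
  where
  ColLE-[] : ∀ {y} → ColLE [] y → y ≡ []
  ColLE-[] {[]} _ = refl

trim-cong : ∀ T U → (∀ i → row T i ≡ row U i) → trim T ≡ trim U
trim-cong [] [] _ = refl
trim-cong [] (y ∷ U) rows with rows 1
... | refl = sym (consT-[] (trim U) (trim-cong [] U λ { zero → sym (row-zero U) ; (suc i) → rows (suc (suc i)) }))
  where
  consT-[] : ∀ V → [] ≡ V → consT [] V ≡ []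
  consT-[] .[] refl = refl
trim-cong (x ∷ T) [] rows with rows 1
... | refl = consT-[] (trim T) (trim-cong T [] λ { zero → row-zero T ; (suc i) → rows (suc (suc i)) })
  where
  consT-[] : ∀ V → V ≡ [] → consT [] V ≡ []
  consT-[] .[] refl = refl
trim-cong (x ∷ T) (y ∷ U) rows with rows 1
... | refl = cong (consT x) (trim-cong T U λ { zero → trans (row-zero T) (sym (row-zero U)) ; (suc i) → rows (suc (suc i)) })

trim-nonEmpty : ∀ {T} → All NonEmpty T → trim T ≡ T
trim-nonEmpty [] = refl
trim-nonEmpty {(a ∷ x) ∷ T} (_ ∷ nonEmpty) = trans (cong (consT (a ∷ x)) (trim-nonEmpty nonEmpty)) (consT-∷ T)
  where
  consT-∷ : ∀ T → consT (a ∷ x) T ≡ (a ∷ x) ∷ T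
  consT-∷ [] = refl
  consT-∷ (y ∷ T) = refl

trim-rowsNonEmpty : ∀ T → ColumnsWeak T → All NonEmpty (trim T)
trim-rowsNonEmpty [] _ = []
trim-rowsNonEmpty ([] ∷ T) cols = subst (All NonEmpty) (sym (cong (consT []) trim-empty)) []
  where
  trim-empty : trim T ≡ []
  trim-empty = trim-cong T [] λ { zero → row-zero T ; (suc i) → rows-empty-below ([] ∷ T) cols refl (suc (suc i)) }
trim-rowsNonEmpty ((a ∷ x) ∷ T) cols = consT-nonEmpty (trim T) (trim-rowsNonEmpty T λ { (suc i) _ → cols (suc (suc i)) (s≤s z≤n) })
  where
  consT-nonEmpty : ∀ V → All NonEmpty V → All NonEmpty (consT (a ∷ x) V)
  consT-nonEmpty [] _ = s≤s z≤n ∷ []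
  consT-nonEmpty (y ∷ V) nonEmpty = s≤s z≤n ∷ nonEmpty

-- IsTableau read off row by row; it does not see trailing empty rows.
record RowwiseTableau (T : Tab) (l : ℕ) : Set where
  field
    increasing : ∀ i → 1 ≤ i → Linked _<_ (row T i)
    columns : ColumnsWeak T
    bounded : ∀ i k → 1 ≤ i → k ∈ row T i → 1 ≤ k × k ≤ l
    complete : ∀ k → 1 ≤ k → k ≤ l → Σ ℕ λ i → 1 ≤ i × k ∈ row T i

  labels-≤ : ∀ i → All (_≤ l) (row T i)
  labels-≤ zero = subst (All (_≤ l)) (sym (row-zero T)) []
  labels-≤ (suc i) = All.tabulate (λ k∈ → proj₂ (bounded (suc i) _ (s≤s z≤n) k∈))

rowwise : ∀ {T l} → IsTableau T l → RowwiseTableau T l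
rowwise {T} (_ , increasing , columns , bounded , complete) = record
  { increasing = λ i _ → All⇒rows [] increasing i
  ; columns = Linked⇒columns columns
  ; bounded = λ i k 1≤i k∈ → bounded k (∈-concat⁺ T i 1≤i k∈)
  ; complete = λ k 1≤k k≤l → ∈-concat⁻ T (complete k 1≤k k≤l)
  }

RowwiseTableau-cong : ∀ {T U l} → (∀ i → row T i ≡ row U i) → RowwiseTableau T l → RowwiseTableau U l
RowwiseTableau-cong {T} {U} rows t = record
  { increasing = λ i 1≤i → subst (Linked _<_) (rows i) (increasing i 1≤i)
  ; columns = λ i 1≤i → subst₂ ColLE (rows i) (rows (suc i)) (columns i 1≤i)
  ; bounded = λ i k 1≤i k∈ → bounded i k 1≤i (subst (k ∈_) (sym (rows i)) k∈)
  ; complete = λ k 1≤k k≤l → let (i , 1≤i , k∈) = complete k 1≤k k≤l in i , 1≤i , subst (k ∈_) (rows i) k∈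
  }
  where open RowwiseTableau t

isTableau-trim : ∀ {T l} → RowwiseTableau T l → IsTableau (trim T) l
isTableau-trim {T} {l} t = isTableau (RowwiseTableau-cong (λ i → sym (row-trim T i)) t)
  where
  isTableau : RowwiseTableau (trim T) l → IsTableau (trim T) l
  isTableau t' =
    trim-rowsNonEmpty T (RowwiseTableau.columns t) ,
    All-rows (trim T) increasing ,
    Linked-rows (trim T) columns ,
    (λ k k∈ → let (i , 1≤i , k∈row) = ∈-concat⁻ (trim T) k∈ in bounded i k 1≤i k∈row) ,
    (λ k 1≤k k≤l → let (i , 1≤i , k∈row) = complete k 1≤k k≤l in ∈-concat⁺ (trim T) i 1≤i k∈row)
    where open RowwiseTableau t'

trim-tableau : ∀ {T l} → IsTableau T l → trim T ≡ T
trim-tableau t = trim-nonEmpty (proj₁ t)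

Linked-tail : ∀ {b ys} → Linked _<_ (b ∷ ys) → Linked _<_ ys
Linked-tail [-] = []
Linked-tail (_ ∷ l) = l

Linked-∷ʳ : ∀ {xs v} → Linked _<_ xs → All (_< v) xs → Linked _<_ (xs ∷ʳ v)
Linked-∷ʳ {[]} _ _ = [-]
Linked-∷ʳ {x ∷ []} _ (x<v ∷ []) = x<v ∷ [-]
Linked-∷ʳ {x ∷ y ∷ xs} (x<y ∷ l) (_ ∷ below) = x<y ∷ Linked-∷ʳ l below

ColLE-∷ʳ : ∀ {x y v} → ColLE x y → All (_≤ v) x → ColLE (x ∷ʳ v) (y ∷ʳ v)
ColLE-∷ʳ {[]} {[]} _ _ = ≤-refl , tt
ColLE-∷ʳ {a ∷ x} {[]} _ (a≤v ∷ _) = a≤v , tt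
ColLE-∷ʳ {a ∷ x} {b ∷ y} (a≤b , c) (_ ∷ below) = a≤b , ColLE-∷ʳ c below

ColLE-∷ʳ-self : ∀ x {v} → ColLE (x ∷ʳ v) x
ColLE-∷ʳ-self [] = tt
ColLE-∷ʳ-self (a ∷ x) = ≤-refl , ColLE-∷ʳ-self x

length-∷ʳ : ∀ (xs : Row) v → length (xs ∷ʳ v) ≡ suc (length xs)
length-∷ʳ xs v = trans (length-++ xs) (+-comm (length xs) 1)

restrictRow-all : ∀ {r xs} → All (_≤ r) xs → restrictRow r xs ≡ xs
restrictRow-all = filter-all (λ v → _ ≤? _)

restrictRow-∷ʳ : ∀ {m r} → m ≤ r → ∀ xs → restrictRow m (xs ∷ʳ suc r) ≡ restrictRow m xs
restrictRow-∷ʳ {m} {r} m≤r xs = begin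
  restrictRow m (xs ∷ʳ suc r)           ≡⟨ filter-++ (λ v → v ≤? m) xs (suc r ∷ []) ⟩
  restrictRow m xs ++ restrictRow m (suc r ∷ []) ≡⟨ cong (restrictRow m xs ++_) (filter-reject (λ v → v ≤? m) (<⇒≱ (s≤s m≤r))) ⟩
  restrictRow m xs ++ []                ≡⟨ ++-identityʳ (restrictRow m xs) ⟩
  restrictRow m xs                      ∎
  where open ≡-Reasoning

restrictRow-none : ∀ {r b ys} → Linked _<_ (b ∷ ys) → ¬ b ≤ r → restrictRow r (b ∷ ys) ≡ []
restrictRow-none {r} l b≰r =
  filter-none (λ v → v ≤? r) (All.map (λ b≤v v≤r → b≰r (≤-trans b≤v v≤r)) (Linked⇒All ≤-trans ≤-refl (Linked.map <⇒≤ l)))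

ColLE-restrictRow : ∀ {r x y} → Linked _<_ x → Linked _<_ y → ColLE x y → ColLE (restrictRow r x) (restrictRow r y)
ColLE-restrictRow {r} {x} {[]} _ _ _ = tt
ColLE-restrictRow {r} {a ∷ x} {b ∷ y} lx ly (a≤b , c) with b ≤? r
... | no b≰r = subst (ColLE (restrictRow r (a ∷ x))) (sym (restrictRow-none ly b≰r)) tt
... | yes b≤r = subst₂ ColLE (sym (filter-accept (λ v → v ≤? r) (≤-trans a≤b b≤r))) (sym (filter-accept (λ v → v ≤? r) b≤r))
                  (a≤b , ColLE-restrictRow (Linked-tail lx) (Linked-tail ly) c)

lastLabel-split : ∀ {r xs} → Linked _<_ xs → All (_≤ suc r) xs →
                  (suc r ∈ xs × xs ≡ restrictRow r xs ∷ʳ suc r) ⊎ (suc r ∉ xs × restrictRow r xs ≡ xs)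
lastLabel-split {r} {[]} _ _ = inj₂ ((λ ()) , refl)
lastLabel-split {r} {x ∷ xs} l (x≤1+r ∷ below) with x ≤? r
... | yes x≤r with lastLabel-split {r} {xs} (Linked-tail l) below
...   | inj₁ (∈xs , xs≡) = inj₁ (there ∈xs , trans (cong (x ∷_) xs≡) (cong (_∷ʳ suc r) (sym (filter-accept (λ v → v ≤? r) x≤r))))
...   | inj₂ (∉xs , ≡xs) = inj₂ ((λ { (here refl) → <-irrefl refl (s≤s x≤r) ; (there ∈xs) → ∉xs ∈xs }) ,
                                 trans (filter-accept (λ v → v ≤? r) x≤r) (cong (x ∷_) ≡xs))
lastLabel-split {r} {x ∷ xs} l (x≤1+r ∷ below) | no x≰r with ≤-antisym x≤1+r (≰⇒> x≰r) | xs | l | below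
... | refl | [] | _ | _ = inj₁ (here refl , cong (_∷ʳ suc r) (sym (filter-reject (λ v → v ≤? r) x≰r)))
... | refl | y ∷ _ | x<y ∷ _ | y≤1+r ∷ _ = ⊥-elim (<⇒≱ x<y y≤1+r)

colLen-++ : ∀ A B j → colLen (A ++ B) j ≡ colLen A j + colLen B j
colLen-++ A B j = trans (cong length (filter-++ (λ x → j ≤? length x) A B)) (length-++ (filter (λ x → j ≤? length x) A))

colLen-∷-long : ∀ {x} T j → j ≤ length x → colLen (x ∷ T) j ≡ suc (colLen T j)
colLen-∷-long T j j≤x = cong length (filter-accept (λ x → j ≤? length x) j≤x)

colLen-∷-short : ∀ {x} T j → ¬ j ≤ length x → colLen (x ∷ T) j ≡ colLen T j
colLen-∷-short T j j≰x = cong length (filter-reject (λ x → j ≤? length x) j≰x)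

colLen-∷-cong : ∀ x {T U} j → colLen T j ≡ colLen U j → colLen (x ∷ T) j ≡ colLen (x ∷ U) j
colLen-∷-cong x {T} {U} j eq with j ≤? length x
... | yes j≤x = trans (colLen-∷-long T j j≤x) (trans (cong suc eq) (sym (colLen-∷-long U j j≤x)))
... | no j≰x = trans (colLen-∷-short T j j≰x) (trans eq (sym (colLen-∷-short U j j≰x)))

colLen-trim : ∀ T j → 1 ≤ j → colLen (trim T) j ≡ colLen T j
colLen-trim [] j _ = refl
colLen-trim ([] ∷ T) j 1≤j = trans (consT-[] (trim T) (colLen-trim T j 1≤j)) (sym (colLen-∷-short T j (<⇒≱ 1≤j)))
  where
  consT-[] : ∀ V → colLen V j ≡ colLen T j → colLen (consT [] V) j ≡ colLen T j
  consT-[] [] eq = eq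
  consT-[] (y ∷ V) eq = trans (colLen-∷-short (y ∷ V) j (<⇒≱ 1≤j)) eq
colLen-trim ((a ∷ x) ∷ T) j 1≤j = trans (cong (λ V → colLen V j) (consT-∷ (trim T))) (colLen-∷-cong (a ∷ x) j (colLen-trim T j 1≤j))
  where
  consT-∷ : ∀ V → consT (a ∷ x) V ≡ (a ∷ x) ∷ V
  consT-∷ [] = refl
  consT-∷ (y ∷ V) = refl

colLen-padTo : ∀ k T j → 1 ≤ j → colLen (padTo k T) j ≡ colLen T j
colLen-padTo zero T j _ = refl
colLen-padTo (suc k) [] j 1≤j = trans (colLen-∷-short (padTo k []) j (<⇒≱ 1≤j)) (colLen-padTo k [] j 1≤j)
colLen-padTo (suc k) (x ∷ T) j 1≤j = colLen-∷-cong x j (colLen-padTo k T j 1≤j)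

colLen-appendFirst : ∀ k v T j → (∀ i → 1 ≤ i → i ≤ k → j ≤ len T i) → colLen (appendFirst k v T) j ≡ colLen T j
colLen-appendFirst zero v T j _ = refl
colLen-appendFirst (suc k) v [] j _ = refl
colLen-appendFirst (suc k) v (x ∷ T) j long = begin
  colLen ((x ∷ʳ v) ∷ appendFirst k v T) j  ≡⟨ colLen-∷-long (appendFirst k v T) j (≤-trans j≤x (subst (length x ≤_) (sym (length-∷ʳ x v)) (n≤1+n _))) ⟩
  suc (colLen (appendFirst k v T) j)       ≡⟨ cong suc (colLen-appendFirst k v T j λ { (suc i) _ i≤k → long (suc (suc i)) (s≤s z≤n) (s≤s i≤k) }) ⟩
  suc (colLen T j)                         ≡⟨ colLen-∷-long T j j≤x ⟨
  colLen (x ∷ T) j                         ∎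
  where
  open ≡-Reasoning
  j≤x : j ≤ length x
  j≤x = long 1 (s≤s z≤n) (s≤s z≤n)

colLen-α : ∀ d X j → 1 ≤ j → j ≤ len X d → colLen (α d X) j ≡ suc (colLen X j)
colLen-α d X j 1≤j j≤Xd = begin
  colLen (α d X) j                                      ≡⟨ colLen-trim (insertRow d (row X d) X) j 1≤j ⟩
  colLen (take d P ++ row X d ∷ drop d P) j             ≡⟨ colLen-++ (take d P) (row X d ∷ drop d P) j ⟩
  colLen (take d P) j + colLen (row X d ∷ drop d P) j   ≡⟨ cong (colLen (take d P) j +_) (colLen-∷-long (drop d P) j j≤Xd) ⟩
  colLen (take d P) j + suc (colLen (drop d P) j)       ≡⟨ +-suc (colLen (take d P) j) (colLen (drop d P) j) ⟩
  suc (colLen (take d P) j + colLen (drop d P) j)       ≡⟨ cong suc (colLen-++ (take d P) (drop d P) j) ⟨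
  suc (colLen (take d P ++ drop d P) j)                 ≡⟨ cong (λ T → suc (colLen T j)) (take++drop≡id d P) ⟩
  suc (colLen P j)                                      ≡⟨ cong suc (colLen-padTo d X j 1≤j) ⟩
  suc (colLen X j)                                      ∎
  where
  open ≡-Reasoning
  P : Tab
  P = padTo d X

-- The map X ↦ β_d (α_d X)

shapeUpTo : Tab → ℕ → Shape
shapeUpTo T k = len (restrict T k)

shapeUpTo-full : ∀ {T l} → RowwiseTableau T l → ∀ i → shapeUpTo T l i ≡ len T i
shapeUpTo-full {T} {l} t i = cong length (trans (row-restrict T l i) (restrictRow-all (RowwiseTableau.labels-≤ t i)))

row-βα-≤ : ∀ d r X i → 1 ≤ i → i ≤ d → row (β d r (α d X)) i ≡ row X i ∷ʳ suc r
row-βα-≤ d r X i 1≤i i≤d = trans (row-β-≤ d r (α d X) i 1≤i i≤d) (cong (_∷ʳ suc r) (trans (row-α d X i) (cong (row X) (predAbove-≤ i≤d))))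

row-βα-> : ∀ d r X i → d < i → row (β d r (α d X)) i ≡ row X (predAbove d i)
row-βα-> d r X i d<i = trans (row-β-> d r (α d X) i d<i) (row-α d X i)

row-βα-suc : ∀ d r X x → d ≤ x → row (β d r (α d X)) (suc x) ≡ row X x
row-βα-suc d r X x d≤x = trans (row-βα-> d r X (suc x) (s≤s d≤x)) (cong (row X) (predAbove-suc d≤x))

len-βα-≤ : ∀ d r X i → 1 ≤ i → i ≤ d → len (β d r (α d X)) i ≡ suc (len X i)
len-βα-≤ d r X i 1≤i i≤d = trans (cong length (row-βα-≤ d r X i 1≤i i≤d)) (length-∷ʳ (row X i) (suc r))

len-βα-> : ∀ d r X i → d < i → len (β d r (α d X)) i ≡ αShape d (len X) i
len-βα-> d r X i d<i = cong length (row-βα-> d r X i d<i)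

row-restrict-βα : ∀ d r X {m} → m ≤ r → ∀ i → row (restrict (β d r (α d X)) m) i ≡ row (restrict X m) (predAbove d i)
row-restrict-βα d r X {m} m≤r i = trans (row-restrict (β d r (α d X)) m i) (restricted i (predAbove-cases d i))
  where
  restricted : ∀ i → PredAboveCase d i →
               restrictRow m (row (β d r (α d X)) i) ≡ row (restrict X m) (predAbove d i)
  restricted zero _ = trans (cong (restrictRow m) (row-zero (β d r (α d X))))
                            (sym (trans (cong (row (restrict X m)) (predAbove-≤ {d} z≤n)) (row-zero (restrict X m))))
  restricted (suc i) (inj₁ (i≤d , eq)) = begin
    restrictRow m (row (β d r (α d X)) (suc i))  ≡⟨ cong (restrictRow m) (row-βα-≤ d r X (suc i) (s≤s z≤n) i≤d) ⟩
    restrictRow m (row X (suc i) ∷ʳ suc r)      ≡⟨ restrictRow-∷ʳ m≤r (row X (suc i)) ⟩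
    restrictRow m (row X (suc i))               ≡⟨ row-restrict X m (suc i) ⟨
    row (restrict X m) (suc i)                  ≡⟨ cong (row (restrict X m)) eq ⟨
    row (restrict X m) (predAbove d (suc i))    ∎
    where open ≡-Reasoning
  restricted (suc i) (inj₂ (d<i , _)) = trans (cong (restrictRow m) (row-βα-> d r X (suc i) d<i)) (sym (row-restrict X m _))

shapeUpTo-βα : ∀ d r X {m} → m ≤ r → ∀ i → shapeUpTo (β d r (α d X)) m i ≡ αShape d (shapeUpTo X m) i
shapeUpTo-βα d r X m≤r i = cong length (row-restrict-βα d r X m≤r i)

colLen-βα : ∀ d r X {j} → ColumnsWeak X → 1 ≤ j → j ≤ len X d → colLen (β d r (α d X)) j ≡ suc (colLen X j)
colLen-βα d r X {j} cols 1≤j j≤Xd = begin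
  colLen (β d r (α d X)) j                               ≡⟨ colLen-trim (appendFirst d (suc r) (padTo d (α d X))) j 1≤j ⟩
  colLen (appendFirst d (suc r) (padTo d (α d X))) j     ≡⟨ colLen-appendFirst d (suc r) (padTo d (α d X)) j long ⟩
  colLen (padTo d (α d X)) j                             ≡⟨ colLen-padTo d (α d X) j 1≤j ⟩
  colLen (α d X) j                                       ≡⟨ colLen-α d X j 1≤j j≤Xd ⟩
  suc (colLen X j)                                       ∎
  where
  open ≡-Reasoning
  long : ∀ i → 1 ≤ i → i ≤ d → j ≤ len (padTo d (α d X)) i
  long i 1≤i i≤d = subst (j ≤_) (sym (cong length (trans (row-padTo d (α d X) i) (trans (row-α d X i) (cong (row X) (predAbove-≤ i≤d))))))
                     (≤-trans j≤Xd (len-antitone {X} cols 1≤i i≤d))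

βα-rowwise : ∀ {d r X} → 1 ≤ d → RowwiseTableau X r → RowwiseTableau (β d r (α d X)) (suc r)
βα-rowwise {d} {r} {X} 1≤d t = record
  { increasing = increasing'
  ; columns = columns'
  ; bounded = bounded'
  ; complete = complete'
  }
  where
  open RowwiseTableau t
  Z : Tab
  Z = β d r (α d X)
  increasing' : ∀ i → 1 ≤ i → Linked _<_ (row Z i)
  increasing' i 1≤i with d <? i
  ... | no d≮i = subst (Linked _<_) (sym (row-βα-≤ d r X i 1≤i (≮⇒≥ d≮i))) (Linked-∷ʳ (increasing i 1≤i) (All.map s≤s (labels-≤ i)))
  ... | yes d<i = subst (Linked _<_) (sym (row-βα-> d r X i d<i)) (increasing (predAbove d i) (predAbove-pos 1≤d 1≤i))
  columns' : ColumnsWeak Z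
  columns' i 1≤i with <-cmp i d
  ... | tri< i<d _ _ = subst₂ ColLE (sym (row-βα-≤ d r X i 1≤i (<⇒≤ i<d))) (sym (row-βα-≤ d r X (suc i) (s≤s z≤n) i<d))
                         (ColLE-∷ʳ (columns i 1≤i) (All.map m≤n⇒m≤1+n (labels-≤ i)))
  ... | tri≈ _ refl _ = subst₂ ColLE (sym (row-βα-≤ d r X d 1≤i ≤-refl)) (sym (row-βα-suc d r X d ≤-refl)) (ColLE-∷ʳ-self (row X d))
  columns' (suc i) _ | tri> _ _ d<i = subst₂ ColLE (sym (row-βα-suc d r X i (s≤s⁻¹ d<i))) (sym (row-βα-suc d r X (suc i) (m≤n⇒m≤1+n (s≤s⁻¹ d<i))))
                                        (columns i (≤-trans 1≤d (s≤s⁻¹ d<i)))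
  bounded' : ∀ i k → 1 ≤ i → k ∈ row Z i → 1 ≤ k × k ≤ suc r
  bounded' i k 1≤i k∈ with d <? i
  ... | yes d<i = let (1≤k , k≤r) = bounded (predAbove d i) k (predAbove-pos 1≤d 1≤i) (subst (k ∈_) (row-βα-> d r X i d<i) k∈)
                  in 1≤k , m≤n⇒m≤1+n k≤r
  ... | no d≮i with ∈-++⁻ (row X i) (subst (k ∈_) (row-βα-≤ d r X i 1≤i (≮⇒≥ d≮i)) k∈)
  ...   | inj₁ k∈X = let (1≤k , k≤r) = bounded i k 1≤i k∈X in 1≤k , m≤n⇒m≤1+n k≤r
  ...   | inj₂ (here refl) = s≤s z≤n , ≤-refl
  complete' : ∀ k → 1 ≤ k → k ≤ suc r → Σ ℕ λ i → 1 ≤ i × k ∈ row Z i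
  complete' k 1≤k k≤1+r with k ≤? r
  ... | no k≰r with ≤-antisym k≤1+r (≰⇒> k≰r)
  ...   | refl = 1 , s≤s z≤n , subst (suc r ∈_) (sym (row-βα-≤ d r X 1 (s≤s z≤n) 1≤d)) (∈-++⁺ʳ (row X 1) (here refl))
  complete' k 1≤k _ | yes k≤r with complete k 1≤k k≤r
  ... | j , 1≤j , k∈ with d <? j
  ...   | no d≮j = j , 1≤j , subst (k ∈_) (sym (row-βα-≤ d r X j 1≤j (≮⇒≥ d≮j))) (∈-++⁺ˡ k∈)
  ...   | yes d<j = suc j , s≤s z≤n , subst (k ∈_) (sym (row-βα-suc d r X j (<⇒≤ d<j))) k∈

βα-isTableau : ∀ {d r X} → 1 ≤ d → IsTableau X r → IsTableau (β d r (α d X)) (suc r)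
βα-isTableau {d} {r} {X} 1≤d t = isTableau-trim {V} (RowwiseTableau-cong (row-trim V) (βα-rowwise 1≤d (rowwise t)))
  where
  V : Tab
  V = appendFirst d (suc r) (padTo d (α d X))

reachesTop-shapes : ∀ {d r X} → 1 ≤ d → IsPsi X r → ReachesTop d (len X) → ∀ k → k ≤ r → ReachesTop d (shapeUpTo X k)
reachesTop-shapes {d} {r} {X} 1≤d (t , covers) top =
  reachesTop-chain r (shapeUpTo X) 1≤d (reachesTop-resp (λ i _ → shapeUpTo-full (rowwise t) i) top) (λ k 1≤k k≤r _ → covers k 1≤k k≤r)

βα-psi : ∀ {d r X} → 1 ≤ d → IsPsi X r → ReachesTop d (len X) → IsPsi (β d r (α d X)) (suc r)
βα-psi {d} {r} {X} 1≤d psi@(t , covers) top = βα-isTableau 1≤d t , covers'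
  where
  Z : Tab
  Z = β d r (α d X)
  covers' : ∀ k → 1 ≤ k → k ≤ suc r → Covers (shapeUpTo Z (k ∸ 1)) (shapeUpTo Z k)
  covers' k 1≤k k≤1+r with m≤n⇒m<n∨m≡n k≤1+r
  ... | inj₁ k<1+r = Covers-resp (shapeUpTo-βα d r X (≤-trans (m∸n≤m k 1) k≤r)) (shapeUpTo-βα d r X k≤r)
                       (covers-αShape 1≤d (reachesTop-shapes 1≤d psi top k k≤r) (covers k 1≤k k≤r))
    where
    k≤r : k ≤ r
    k≤r = s≤s⁻¹ k<1+r
  ... | inj₂ refl = Covers-resp (λ i → trans (shapeUpTo-βα d r X ≤-refl i) (shapeUpTo-full (rowwise t) (predAbove d i)))
                                (shapeUpTo-full (βα-rowwise 1≤d (rowwise t)))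
                      (covers-raised 1≤d top (len-βα-≤ d r X) (len-βα-> d r X))

InDelta-pred : ∀ {n X} → 1 ≤ n → InDelta (n ∸ 1) X ⇔ (∀ i → 1 ≤ i → len X i ≤ n ∸ i)
InDelta-pred {suc n} _ = mk⇔ id id

βα-inDelta : ∀ {n d r X} → 1 ≤ d → d ≤ n → InDelta (n ∸ 1) X → InDelta n (β d r (α d X))
βα-inDelta {n} {d} {r} {X} 1≤d d≤n δ = bound
  where
  δ' : ∀ i → 1 ≤ i → len X i ≤ n ∸ i
  δ' = to (InDelta-pred {X = X} (≤-trans 1≤d d≤n)) δ
  bound : InDelta n (β d r (α d X))
  bound (suc j) 1≤i with d ≤? j
  ... | no d≰j = subst (_≤ n ∸ j) (sym (len-βα-≤ d r X (suc j) 1≤i (≰⇒> d≰j)))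
                   (subst (suc (len X (suc j)) ≤_) (sym (+-∸-assoc 1 (≤-trans (≰⇒> d≰j) d≤n))) (s≤s (δ' (suc j) 1≤i)))
  ... | yes d≤j = subst (_≤ n ∸ j) (sym (cong length (row-βα-suc d r X j d≤j))) (δ' j (≤-trans 1≤d d≤j))

lookupM-∷ʳ : ∀ xs v → lookupM (xs ∷ʳ v) (length xs) ≡ just v
lookupM-∷ʳ [] v = refl
lookupM-∷ʳ (x ∷ xs) v = lookupM-∷ʳ xs v

βα-InZ : ∀ {n d r X} → 1 ≤ d → d ≤ n → InX r d n X → InZ r d n (β d r (α d X))
βα-InZ {n} {d} {r} {X} 1≤d d≤n (psi@(t , _) , δ , Xd≡n∸d , height-d) =
  βα-psi 1≤d psi top , βα-inDelta 1≤d d≤n δ , identical-rows , (last-box , no-label-below) , height-d'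
  where
  Z : Tab
  Z = β d r (α d X)
  top : ReachesTop d (len X)
  top = IsHeight⇒reachesTop {Y = len X} height-d
  identical-rows : row (restrict Z r) d ≡ row (restrict Z r) (suc d)
  identical-rows = begin
    row (restrict Z r) d                        ≡⟨ row-restrict-βα d r X ≤-refl d ⟩
    row (restrict X r) (predAbove d d)          ≡⟨ cong (row (restrict X r)) (trans (predAbove-≤ {d} ≤-refl) (sym (predAbove-suc {d} ≤-refl))) ⟩
    row (restrict X r) (predAbove d (suc d))    ≡⟨ row-restrict-βα d r X ≤-refl (suc d) ⟨
    row (restrict Z r) (suc d)                  ∎
    where open ≡-Reasoning
  last-box : entry Z d (suc (n ∸ d)) ≡ just (suc r)
  last-box = trans (cong (λ xs → lookupM xs (n ∸ d)) (row-βα-≤ d r X d 1≤d ≤-refl))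
                   (subst (λ m → lookupM (row X d ∷ʳ suc r) m ≡ just (suc r)) Xd≡n∸d (lookupM-∷ʳ (row X d) (suc r)))
  no-label-below : ∀ i → d < i → suc r ∉ row Z i
  no-label-below i d<i 1+r∈ = <-irrefl refl (proj₂ (RowwiseTableau.bounded (rowwise t) (predAbove d i) (suc r)
                                 (predAbove-pos 1≤d (≤-trans 1≤d (<⇒≤ d<i))) (subst (suc r ∈_) (row-βα-> d r X i d<i) 1+r∈)))
  height-d' : IsHeight (len Z) d d
  height-d' = reachesTop⇒IsHeight {Y = len Z} 1≤d (to (reachesTop-raise (len-βα-≤ d r X)) top)

βα-injective : ∀ {d r X X'} → IsTableau X r → IsTableau X' r → β d r (α d X) ≡ β d r (α d X') → X ≡ X'
βα-injective {d} {r} {X} {X'} t t' same = begin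
  X        ≡⟨ trim-tableau t ⟨
  trim X   ≡⟨ trim-cong X X' (row-cong {X} {X'} rows) ⟩
  trim X'  ≡⟨ trim-tableau t' ⟩
  X'       ∎
  where
  open ≡-Reasoning
  same-row : ∀ i → row (β d r (α d X)) i ≡ row (β d r (α d X')) i
  same-row i = cong (λ T → row T i) same
  rows : ∀ i → 1 ≤ i → row X i ≡ row X' i
  rows i 1≤i with d <? i
  ... | no d≮i = ∷ʳ-injectiveˡ (row X i) (row X' i)
                   (trans (sym (row-βα-≤ d r X i 1≤i (≮⇒≥ d≮i))) (trans (same-row i) (row-βα-≤ d r X' i 1≤i (≮⇒≥ d≮i))))
  ... | yes d<i = trans (sym (row-βα-suc d r X i (<⇒≤ d<i))) (trans (same-row (suc i)) (row-βα-suc d r X' i (<⇒≤ d<i)))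

lastLabel⇔InStrip : ∀ {Z r x h} → RowwiseTableau Z (suc r) → StripRemoved (shapeUpTo Z r) (len Z) x h →
                    1 ≤ x → len Z (suc x) < len Z x → ∀ i → 1 ≤ i → suc r ∈ row Z i ⇔ InStrip x h i
lastLabel⇔InStrip {Z} {r} {x} {h} t removed@(inside , outside) 1≤x corner i 1≤i = mk⇔ in-strip has-label
  where
  open RowwiseTableau t
  split : (suc r ∈ row Z i × row Z i ≡ restrictRow r (row Z i) ∷ʳ suc r) ⊎ (suc r ∉ row Z i × restrictRow r (row Z i) ≡ row Z i)
  split = lastLabel-split {r} (increasing i 1≤i) (labels-≤ i)
  restricted-len : shapeUpTo Z r i ≡ length (restrictRow r (row Z i))
  restricted-len = cong length (row-restrict Z r i)
  in-strip : suc r ∈ row Z i → InStrip x h i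
  in-strip 1+r∈ with InStrip? x h i | split
  ... | yes i∈ | _ = i∈
  ... | no _ | inj₂ (1+r∉ , _) = ⊥-elim (1+r∉ 1+r∈)
  ... | no i∉ | inj₁ (_ , row≡) = ⊥-elim (1+n≢n (sym grown))
    where
    grown : len Z i ≡ suc (len Z i)
    grown = trans (cong length row≡) (trans (length-∷ʳ (restrictRow r (row Z i)) (suc r))
                  (cong suc (trans (sym restricted-len) (outside i 1≤i i∉))))
  has-label : InStrip x h i → suc r ∈ row Z i
  has-label i∈@(_ , i≤x) with split
  ... | inj₁ (1+r∈ , _) = 1+r∈
  ... | inj₂ (_ , unchanged) = ⊥-elim (<-irrefl fixed (∸-monoʳ-< {len Z i} {1} {0} (s≤s z≤n) (≤-trans (s≤s z≤n) (≤-trans corner (len-antitone {Z} columns 1≤i i≤x)))))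
    where
    fixed : len Z i ∸ 1 ≡ len Z i
    fixed = trans (sym (inside i 1≤i i∈)) (trans restricted-len (cong length unchanged))

-- Its inverse

-- deleteRow d T removes row d + 1 of T, undoing α d.
deleteRow : ℕ → Tab → Tab
deleteRow d [] = []
deleteRow zero (x ∷ T) = T
deleteRow (suc d) (x ∷ T) = x ∷ deleteRow d T

sucAbove-suc : ∀ d j → sucAbove (suc d) (suc j) ≡ suc (sucAbove d j)
sucAbove-suc d j with sucAbove-cases d j
... | inj₁ (j≤d , eq) = trans (sucAbove-≤ (s≤s j≤d)) (cong suc (sym eq))
... | inj₂ (d<j , eq) = trans (sucAbove-> (s≤s d<j)) (cong suc (sym eq))

row-deleteRow : ∀ d T j → row (deleteRow d T) j ≡ row T (sucAbove d j)
row-deleteRow d T zero = trans (row-zero (deleteRow d T)) (sym (trans (cong (row T) (sucAbove-≤ {d} z≤n)) (row-zero T)))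
row-deleteRow d [] (suc j) = refl
row-deleteRow zero (x ∷ T) (suc j) = cong (row (x ∷ T)) (sym (sucAbove-> {0} (s≤s z≤n)))
row-deleteRow (suc d) (x ∷ T) (suc zero) = cong (row (x ∷ T)) (sym (sucAbove-≤ {suc d} (s≤s z≤n)))
row-deleteRow (suc d) (x ∷ T) (suc (suc j)) = begin
  row (deleteRow d T) (suc j)               ≡⟨ row-deleteRow d T (suc j) ⟩
  row T (sucAbove d (suc j))                ≡⟨ row-∷ (sucAbove d (suc j)) (sucAbove-pos (s≤s z≤n)) ⟨
  row (x ∷ T) (suc (sucAbove d (suc j)))    ≡⟨ cong (row (x ∷ T)) (sucAbove-suc d (suc j)) ⟨
  row (x ∷ T) (sucAbove (suc d) (suc (suc j))) ∎
  where
  open ≡-Reasoning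
  row-∷ : ∀ m → 1 ≤ m → row (x ∷ T) (suc m) ≡ row T m
  row-∷ (suc m) _ = refl

lookupM-< : ∀ xs j {v} → lookupM xs j ≡ just v → j < length xs
lookupM-< (x ∷ xs) zero _ = s≤s z≤n
lookupM-< (x ∷ xs) (suc j) eq = s≤s (lookupM-< xs j eq)

lookupM-∈ : ∀ xs j {v} → lookupM xs j ≡ just v → v ∈ xs
lookupM-∈ (x ∷ xs) zero refl = here refl
lookupM-∈ (x ∷ xs) (suc j) eq = there (lookupM-∈ xs j eq)

module Preimage {n d r Z} (1≤d : 1 ≤ d) (d≤n : d ≤ n) (psi : IsPsi Z (suc r)) (δ : InDelta n Z)
                (identical : row (restrict Z r) d ≡ row (restrict Z r) (suc d))
                (last-box : entry Z d (suc (n ∸ d)) ≡ just (suc r)) (no-label-below : ∀ i → d < i → suc r ∉ row Z i)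
                (height-d : IsHeight (len Z) d d) where

  Z-rowwise : RowwiseTableau Z (suc r)
  Z-rowwise = rowwise (proj₁ psi)

  open RowwiseTableau Z-rowwise

  W : Tab
  W = restrict Z r

  -- The boxes labelled r + 1 form the strip of row d, which reaches the top.
  labelled-top-rows : ∀ i → 1 ≤ i → i ≤ d → suc r ∈ row Z i
  labelled-top-rows = labelled (Covers-resp (λ _ → refl) (λ i → sym (shapeUpTo-full (Z-rowwise) i))
                                            (proj₂ psi (suc r) (s≤s z≤n) ≤-refl))
    where
    labelled : Covers (shapeUpTo Z r) (len Z) → ∀ i → 1 ≤ i → i ≤ d → suc r ∈ row Z i
    labelled (x , 1≤x , corner , h , H , removed) i 1≤i i≤d with ≤-antisym x≤d d≤x
      where
      strip⇔ : ∀ i → 1 ≤ i → suc r ∈ row Z i ⇔ InStrip x h i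
      strip⇔ = lastLabel⇔InStrip {x = x} {h} (Z-rowwise) removed 1≤x corner
      d≤x : d ≤ x
      d≤x = proj₂ (to (strip⇔ d 1≤d) (lookupM-∈ (row Z d) (n ∸ d) last-box))
      x∈ : InStrip x h x
      x∈ = ∸-monoʳ-< {x} {h} {0} (proj₁ H) (IsHeight-≤ {len Z} 1≤x H) , ≤-refl
      x≤d : x ≤ d
      x≤d with x ≤? d
      ... | yes x≤d = x≤d
      ... | no x≰d = ⊥-elim (no-label-below x (≰⇒> x≰d) (from (strip⇔ x 1≤x) x∈))
    ... | refl with IsHeight-unique {len Z} H height-d
    ...   | refl = from (lastLabel⇔InStrip {x = x} {x} (Z-rowwise) removed 1≤x corner i 1≤i)
                        (InStrip-top 1≤i i≤d)

  row-W : ∀ i → row W i ≡ restrictRow r (row Z i)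
  row-W = row-restrict Z r

  row-Z-≤ : ∀ i → 1 ≤ i → i ≤ d → row Z i ≡ row W i ∷ʳ suc r
  row-Z-≤ i 1≤i i≤d with lastLabel-split {r} (increasing i 1≤i) (labels-≤ i)
  ... | inj₁ (_ , row≡) = trans row≡ (cong (_∷ʳ suc r) (sym (row-W i)))
  ... | inj₂ (1+r∉ , _) = ⊥-elim (1+r∉ (labelled-top-rows i 1≤i i≤d))

  row-W-> : ∀ i → 1 ≤ i → d < i → row W i ≡ row Z i
  row-W-> i 1≤i d<i with lastLabel-split {r} (increasing i 1≤i) (labels-≤ i)
  ... | inj₁ (1+r∈ , _) = ⊥-elim (no-label-below i d<i 1+r∈)
  ... | inj₂ (_ , unchanged) = trans (row-W i) unchanged

  X : Tab
  X = trim (deleteRow d W)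

  row-X : ∀ j → row X j ≡ row W (sucAbove d j)
  row-X j = trans (row-trim (deleteRow d W) j) (row-deleteRow d W j)

  row-W-sucAbove-predAbove : ∀ i → row W (sucAbove d (predAbove d i)) ≡ row W i
  row-W-sucAbove-predAbove zero = cong (row W) (sucAbove-predAbove-≤ {d} z≤n)
  row-W-sucAbove-predAbove (suc j) with <-cmp j d
  ... | tri< j<d _ _ = cong (row W) (sucAbove-predAbove-≤ j<d)
  ... | tri≈ _ refl _ = trans (cong (row W) (trans (cong (sucAbove d) (predAbove-suc {d} ≤-refl)) (sucAbove-≤ {d} ≤-refl))) identical
  ... | tri> _ _ d<j = cong (row W) (trans (cong (sucAbove d) (predAbove-suc (<⇒≤ d<j))) (sucAbove-> d<j))

  row-αX : ∀ i → row (α d X) i ≡ row W i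
  row-αX i = trans (row-α d X i) (trans (row-X (predAbove d i)) (row-W-sucAbove-predAbove i))

  βαX≡Z : β d r (α d X) ≡ Z
  βαX≡Z = trans (trim-cong (appendFirst d (suc r) (padTo d (α d X))) Z (row-cong {appendFirst d (suc r) (padTo d (α d X))} {Z} rows)) (trim-tableau (proj₁ psi))
    where
    rows : ∀ i → 1 ≤ i → row (appendFirst d (suc r) (padTo d (α d X))) i ≡ row Z i
    rows i 1≤i with d <? i
    ... | no d≮i = trans (row-appendFirst-≤ d (suc r) (α d X) i 1≤i (≮⇒≥ d≮i))
                         (trans (cong (_∷ʳ suc r) (row-αX i)) (sym (row-Z-≤ i 1≤i (≮⇒≥ d≮i))))
    ... | yes d<i = trans (row-appendFirst-> d (suc r) (α d X) i d<i) (trans (row-αX i) (row-W-> i 1≤i d<i))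

  W-increasing : ∀ i → 1 ≤ i → Linked _<_ (row W i)
  W-increasing i 1≤i = subst (Linked _<_) (sym (row-W i)) (Linked-filter⁺ (λ v → v ≤? r) <-trans (increasing i 1≤i))

  W-columns : ColumnsWeak W
  W-columns i 1≤i = subst₂ ColLE (sym (row-W i)) (sym (row-W (suc i)))
                      (ColLE-restrictRow (increasing i 1≤i) (increasing (suc i) (s≤s z≤n)) (columns i 1≤i))

  X-rowwise : RowwiseTableau (deleteRow d W) r
  X-rowwise = record
    { increasing = λ j 1≤j → subst (Linked _<_) (sym (row-deleteRow d W j)) (W-increasing (sucAbove d j) (sucAbove-pos 1≤j))
    ; columns = columns'
    ; bounded = bounded'
    ; complete = complete'
    }
    where
    row-D : ∀ j → row (deleteRow d W) j ≡ row W (sucAbove d j)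
    row-D = row-deleteRow d W
    columns' : ColumnsWeak (deleteRow d W)
    columns' j 1≤j with <-cmp j d
    ... | tri< j<d _ _ = subst₂ ColLE (sym (trans (row-D j) (cong (row W) (sucAbove-≤ (<⇒≤ j<d)))))
                                      (sym (trans (row-D (suc j)) (cong (row W) (sucAbove-≤ j<d)))) (W-columns j 1≤j)
    ... | tri≈ _ refl _ = subst₂ ColLE (sym (trans (row-D d) (trans (cong (row W) (sucAbove-≤ {d} ≤-refl)) identical)))
                                       (sym (trans (row-D (suc d)) (cong (row W) (sucAbove-> {d} ≤-refl)))) (W-columns (suc d) (s≤s z≤n))
    ... | tri> _ _ d<j = subst₂ ColLE (sym (trans (row-D j) (cong (row W) (sucAbove-> d<j))))
                                      (sym (trans (row-D (suc j)) (cong (row W) (sucAbove-> (m≤n⇒m≤1+n d<j))))) (W-columns (suc j) (s≤s z≤n))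
    bounded' : ∀ j k → 1 ≤ j → k ∈ row (deleteRow d W) j → 1 ≤ k × k ≤ r
    bounded' j k 1≤j k∈ = proj₁ (bounded (sucAbove d j) k (sucAbove-pos 1≤j) k∈Z) , k≤r
      where
      k∈Z×k≤r : k ∈ row Z (sucAbove d j) × k ≤ r
      k∈Z×k≤r = ∈-filter⁻ (λ v → v ≤? r) (subst (k ∈_) (trans (row-D j) (row-W (sucAbove d j))) k∈)
      k∈Z : k ∈ row Z (sucAbove d j)
      k∈Z = proj₁ k∈Z×k≤r
      k≤r : k ≤ r
      k≤r = proj₂ k∈Z×k≤r
    complete' : ∀ k → 1 ≤ k → k ≤ r → Σ ℕ λ j → 1 ≤ j × k ∈ row (deleteRow d W) j
    complete' k 1≤k k≤r with complete k 1≤k (m≤n⇒m≤1+n k≤r)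
    ... | i , 1≤i , k∈ = predAbove d i , predAbove-pos 1≤d 1≤i ,
                         subst (k ∈_) (sym (trans (row-D (predAbove d i)) (row-W-sucAbove-predAbove i)))
                           (subst (k ∈_) (sym (row-W i)) (∈-filter⁺ (λ v → v ≤? r) k∈ k≤r))

  X-tableau : IsTableau X r
  X-tableau = isTableau-trim X-rowwise

  len-Z-≤ : ∀ i → 1 ≤ i → i ≤ d → len Z i ≡ suc (len X i)
  len-Z-≤ i 1≤i i≤d = trans (cong (λ T → len T i) (sym βαX≡Z)) (len-βα-≤ d r X i 1≤i i≤d)

  len-Z-suc : ∀ i → d ≤ i → len Z (suc i) ≡ len X i
  len-Z-suc i d≤i = trans (cong (λ T → len T (suc i)) (sym βαX≡Z)) (cong length (row-βα-suc d r X i d≤i))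

  shape-Z : ∀ {m} → m ≤ r → ∀ i → shapeUpTo Z m i ≡ αShape d (shapeUpTo X m) i
  shape-Z {m} m≤r i = trans (cong (λ T → shapeUpTo T m i) (sym βαX≡Z)) (shapeUpTo-βα d r X m≤r i)

  X-reachesTop : ReachesTop d (len X)
  X-reachesTop = from (reachesTop-raise len-Z-≤) (IsHeight⇒reachesTop {Y = len Z} height-d)

  X-psi : IsPsi X r
  X-psi = X-tableau , λ k 1≤k k≤r → covers-X k 1≤k k≤r (tops k k≤r)
    where
    covers-X : ∀ k → 1 ≤ k → k ≤ r → ReachesTop d (shapeUpTo X k) → Covers (shapeUpTo X (k ∸ 1)) (shapeUpTo X k)
    covers-X k 1≤k k≤r top = covers-αShape⁻¹ 1≤d top
      (Covers-resp (λ i → sym (shape-Z (≤-trans (m∸n≤m k 1) k≤r) i)) (λ i → sym (shape-Z k≤r i)) (proj₂ psi k 1≤k (m≤n⇒m≤1+n k≤r)))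
    tops : ∀ k → k ≤ r → ReachesTop d (shapeUpTo X k)
    tops = reachesTop-chain r (shapeUpTo X) 1≤d (reachesTop-resp (λ i _ → shapeUpTo-full (rowwise X-tableau) i) X-reachesTop) covers-X

  X-inDelta : InDelta (n ∸ 1) X
  X-inDelta = from (InDelta-pred {X = X} (≤-trans 1≤d d≤n)) bound
    where
    bound : ∀ i → 1 ≤ i → len X i ≤ n ∸ i
    bound i 1≤i with i ≤? d
    ... | yes i≤d = s≤s⁻¹ (subst₂ _≤_ (len-Z-≤ i 1≤i i≤d) (+-∸-assoc 1 (≤-trans i≤d d≤n)) (δ i 1≤i))
    ... | no i≰d = subst (_≤ n ∸ i) (len-Z-suc i (<⇒≤ (≰⇒> i≰d))) (δ (suc i) (s≤s z≤n))

  X-row-d : len X d ≡ n ∸ d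
  X-row-d = ≤-antisym (s≤s⁻¹ (subst₂ _≤_ (len-Z-≤ d 1≤d ≤-refl) (+-∸-assoc 1 d≤n) (δ d 1≤d)))
                      (s≤s⁻¹ (subst (suc (n ∸ d) ≤_) (len-Z-≤ d 1≤d ≤-refl) (lookupM-< (row Z d) (n ∸ d) last-box)))

  X-InX : InX r d n X
  X-InX = X-psi , X-inDelta , X-row-d , reachesTop⇒IsHeight {Y = len X} 1≤d X-reachesTop

βα-surjective : ∀ {n d r Z} → 1 ≤ d → d ≤ n → InZ r d n Z → Σ Tab (λ X → InX r d n X × β d r (α d X) ≡ Z)
βα-surjective 1≤d d≤n (psi , δ , identical , (last-box , no-label-below) , height-d) = X , X-InX , βαX≡Z
  where open Preimage 1≤d d≤n psi δ identical last-box no-label-below height-d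

theorem4p3 : (n d r : ℕ) → 1 ≤ d → d ≤ n →
    ((X : Tab) → IsTableau X r → len X d ≡ n ∸ d →
      ((i : ℕ) → 1 ≤ i → i ≤ d → len (β d r (α d X)) i ≡ suc (len X i)) ×
      ((j : ℕ) → 1 ≤ j → j ≤ n ∸ d → colLen (β d r (α d X)) j ≡ suc (colLen X j)))
    ×
    (((X : Tab) → InX r d n X → InZ r d n (β d r (α d X))) ×
     ((X X' : Tab) → InX r d n X → InX r d n X' → β d r (α d X) ≡ β d r (α d X') → X ≡ X') ×
     ((Z : Tab) → InZ r d n Z → Σ Tab (λ X → InX r d n X × β d r (α d X) ≡ Z)))
theorem4p3 n d r 1≤d d≤n =
  (λ X t Xd≡n∸d →
     len-βα-≤ d r X ,
     λ j 1≤j j≤n∸d → colLen-βα d r X (RowwiseTableau.columns (rowwise t)) 1≤j (subst (j ≤_) (sym Xd≡n∸d) j≤n∸d)) ,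
  (λ X → βα-InZ 1≤d d≤n) ,
  (λ X X' ((t , _) , _) ((t' , _) , _) → βα-injective {d} t t') ,
  (λ Z → βα-surjective 1≤d d≤n)
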